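{- Let $G$ be a subgraph of $K_n$. Then: (1) if $G$, regarded as a graph on its $v(G)$ non-isolated vertices, has exactly $N$ connected components, then $q_0(G)=2^{N-v(G)}$; (2) if $G$ has exactly $m$ bridges, then $q_1(G)=m\,q_0(G)$; (3) if $G$ has a vertex of odd degree, then $q_k(G)\le1/2$ for every $k\ge0$; (4) for every odd $k$, $q_k(G)\le 1/2$; (5) $q_2(G)\le 3/4$.
   Context: Let $(V_1,V_2)$ be a random bipartition of $[n]$, each vertex independently in either part with probability $1/2$, and $B$ the set of edges of $K_n$ between $V_1$ and $V_2$ (so $G\cap B$ is a uniform random cut of $G$). For $k\ge0$, $q_k(G)=\Pr[|G\cap B|=k]$. A bridge of $G$ is an edge whose removal increases the number of connected components. -}

module Defs where

open import Data.Bool using (Bool; true; false; T; _∧_; _∨_; not; _xor_; if_then_else_)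
open import Data.Nat using (ℕ; zero; suc; _+_; _^_; _<ᵇ_; _≡ᵇ_; _<_; _<?_; _%_)
open import Data.Nat.Properties using (m^n≢0)
open import Data.Fin using (Fin; toℕ; _≟_)
open import Data.Vec.Functional using (_∷_)
open import Data.Integer using (+_)
open import Data.Rational using (ℚ; _/_)
open import Data.Product using (Σ; _×_; _,_; proj₁)
open import Data.List using (List; length)
open import Data.List.Membership.Propositional using (_∈_)
open import Data.List.Relation.Unary.Unique.Propositional using (Unique)
open import Function using (_⇔_; Surjective)
open import Relation.Binary.PropositionalEquality using (_≡_)
open import Relation.Nullary.Decidable using (⌊_⌋)

record Graph (n : ℕ) : Set where
  field
    adj    : Fin n → Fin n → Bool
    sym    : ∀ i j → adj i j ≡ adj j i
    irrefl : ∀ i → adj i i ≡ false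
open Graph public

count : ∀ {n} → (Fin n → Bool) → ℕ
count {zero}  f = 0
count {suc n} f = (if f Fin.zero then 1 else 0) + count (λ i → f (Fin.suc i))

-- number of bipartitions σ : Fin n → Bool (σ i = true ⇔ i ∈ V₁)
-- satisfying a Boolean predicate; there are 2 ^ n bipartitions in total
countBip : ∀ n → ((Fin n → Bool) → Bool) → ℕ
countBip zero    P = if P (λ ()) then 1 else 0
countBip (suc n) P = countBip n (λ σ → P (true ∷ σ)) + countBip n (λ σ → P (false ∷ σ))

sumF : ∀ {n} → (Fin n → ℕ) → ℕ
sumF {zero}  f = 0
sumF {suc n} f = f Fin.zero + sumF (λ i → f (Fin.suc i))

cutSize : ∀ {n} → Graph n → (Fin n → Bool) → ℕ
cutSize G σ = sumF (λ i → count (λ j → (toℕ i <ᵇ toℕ j) ∧ adj G i j ∧ (σ i xor σ j)))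

cutCount : ∀ {n} → Graph n → ℕ → ℕ
cutCount {n} G k = countBip n (λ σ → cutSize G σ ≡ᵇ k)

-- q_k(G) = Pr[|G ∩ B| = k] = cutCount G k / 2 ^ n
q : ∀ {n} → Graph n → ℕ → ℚ
q {n} G k = _/_ (+ cutCount G k) (2 ^ n) {{m^n≢0 2 n}}

ℕ→ℚ : ℕ → ℚ
ℕ→ℚ k = + k / 1

deg : ∀ {n} → Graph n → Fin n → ℕ
deg G i = count (adj G i)

nonIsolated : ∀ {n} → Graph n → Fin n → Bool
nonIsolated G i = ⌊ 0 <? deg G i ⌋

v : ∀ {n} → Graph n → ℕ
v G = count (nonIsolated G)

data Reach {n : ℕ} (a : Fin n → Fin n → Bool) : Fin n → Fin n → Set where
  here : ∀ {i} → Reach a i i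
  step : ∀ {i k j} → T (a i k) → Reach a k j → Reach a i j

-- G regarded as a graph on its non-isolated vertices has exactly N
-- connected components: a surjective labelling of the non-isolated
-- vertices by Fin N whose fibres are exactly the connected components.
HasComponentsNonIso : ∀ {n} → Graph n → ℕ → Set
HasComponentsNonIso {n} G N =
  Σ (Σ (Fin n) (λ i → T (nonIsolated G i)) → Fin N) λ c →
    Surjective _≡_ _≡_ c ×
    (∀ x y → (c x ≡ c y) ⇔ Reach (adj G) (proj₁ x) (proj₁ y))

HasComponents : ∀ {n} → (Fin n → Fin n → Bool) → ℕ → Set
HasComponents {n} a N =
  Σ (Fin n → Fin N) λ c →
    Surjective _≡_ _≡_ c ×
    (∀ x y → (c x ≡ c y) ⇔ Reach a x y)

removeEdge : ∀ {n} → Graph n → Fin n → Fin n → (Fin n → Fin n → Bool)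
removeEdge G a b i j =
  adj G i j ∧ not ((⌊ i ≟ a ⌋ ∧ ⌊ j ≟ b ⌋) ∨ (⌊ i ≟ b ⌋ ∧ ⌊ j ≟ a ⌋))

IsBridge : ∀ {n} → Graph n → Fin n → Fin n → Set
IsBridge G a b =
  T (adj G a b) ×
  Σ ℕ λ N → Σ ℕ λ N' →
    HasComponents (adj G) N × HasComponents (removeEdge G a b) N' × N < N'

HasBridges : ∀ {n} → Graph n → ℕ → Set
HasBridges {n} G m =
  Σ (List (Fin n × Fin n)) λ bs →
    Unique bs × length bs ≡ m ×
    (∀ a b → ((a , b) ∈ bs) ⇔ (toℕ a < toℕ b × IsBridge G a b))

-- Write cutCount G k for the number of bipartitions σ cutting exactly k edges, so that q_k(G) = cutCount G k / 2^n.
-- (1) The cut of σ is empty iff σ is constant on every component, so the empty cuts are a free choice of side for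
-- each of the N components and each of the n − v(G) isolated vertices.
-- (2) If σ cuts exactly one edge xy, then no walk of G − xy joins x to y, so xy is a bridge. Conversely, for a bridge
-- xy, moving the whole component of x in G − xy to the other side is a bijection between the bipartitions cutting
-- only xy and the empty cuts.
-- (3)-(5) Moving a vertex u to the other side changes the cut by deg u − 2r, where r is the number of neighbours of
-- u across the cut. If deg u is odd, σ and its move never cut the same number of edges, so each value is taken by
-- at most half of the bipartitions. If all degrees are even, every cut is even. For an edge uv, moving v changes r
-- for u by one, so σ and its moves at u, at v and at both cannot all cut exactly two edges.

module Submission where

open import Defs hiding (sym)

module Cuts where

  open import Data.Nat.Properties hiding (<-cmp; suc-injective) renaming (_≟_ to _≟ℕ_)
  open import Algebra.Properties.CommutativeMonoid.Sum +-0-commutativeMonoid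
    using (sum; sum-syntax; sum-cong-≗; sum-remove; sum-replicate-zero; ∑-distrib-+; ∑-comm)
  open import Algebra.Properties.Semiring.Sum +-*-semiring using (*-distribʳ-sum)
  open import Data.Bool using (Bool; true; false; T; _∧_; _∨_; not; _xor_; if_then_else_)
  open import Data.Bool.Properties
    using (T?; T-≡; T-∧; T-∨; not-¬; not-injective; not-involutive; not-distribˡ-xor; ∧-comm; ∨-comm; ∧-identityʳ;
           ∧-zeroʳ; xor-same; xor-comm)
  open import Data.Empty using (⊥-elim)
  open import Data.Fin using (Fin; zero; suc; toℕ; _≟_; punchIn; punchOut)
  open import Data.Fin.Patterns using (0F; 1F; 2F; 3F)
  open import Data.Fin.Properties
    using (suc-injective; <-cmp; any?; injective⇒≤; punchInᵢ≢i; punchOut-cong; punchIn-punchOut; punchOut-punchIn)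
  open import Data.List using (List; length)
  import Data.List as List
  open import Data.List.Membership.Propositional using (_∈_; _∉_)
  import Data.List.Relation.Unary.Any as Any
  open import Data.List.Relation.Unary.Any using (here; there)
  open import Data.List.Relation.Unary.All.Properties using (All¬⇒¬Any)
  import Data.List.Relation.Unary.AllPairs as AllPairs
  open import Data.List.Relation.Unary.Unique.Propositional using (Unique)
  open import Data.Maybe using (Maybe; just; nothing; is-nothing)
  open import Data.Maybe.Properties using (just-injective; ≡-dec)
  open import Data.Nat using (ℕ; zero; suc; _+_; _*_; _^_; _%_; _≤_; _<_; z≤n; s≤s; s≤s⁻¹; _<ᵇ_; _≡ᵇ_)
  open import Data.Nat.DivMod using (m%n<n; m*n%n≡0; [m+kn]%n≡m%n; %-distribˡ-+; m%n%n≡m%n)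
  open import Data.Nat.Tactic.RingSolver using (solve-∀)
  open import Data.Product using (Σ; ∃; _×_; _,_; proj₁; proj₂)
  open import Data.Product.Properties using () renaming (≡-dec to ×-≡-dec)
  open import Data.Sum using (inj₁; inj₂)
  open import Data.Unit using (⊤; tt)
  open import Data.Vec.Functional using (_∷_; []; updateAt)
  open import Data.Vec.Functional.Properties using (updateAt-updates; updateAt-minimal)
  open import Function using (id; _∘_; Equivalence; _⇔_; mk⇔)
  open import Relation.Binary.Definitions using (DecidableEquality; tri<; tri≈; tri>)
  open import Relation.Binary.PropositionalEquality
  open import Relation.Binary.Structures using (IsDecEquivalence)
  open import Relation.Nullary using (¬_; Dec; yes; no; _×-dec_)
  open import Relation.Nullary.Decidable using (⌊_⌋; fromWitness; toWitness)

  𝟙 : Bool → ℕ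
  𝟙 b = if b then 1 else 0

  𝟙-true : ∀ {b} → T b → 𝟙 b ≡ 1
  𝟙-true {true} _ = refl

  𝟙-false : ∀ {b} → ¬ T b → 𝟙 b ≡ 0
  𝟙-false {false} _   = refl
  𝟙-false {true}  ¬tt = ⊥-elim (¬tt tt)

  𝟙-∧ : ∀ b c → 𝟙 (b ∧ c) ≡ 𝟙 b * 𝟙 c
  𝟙-∧ true  c = sym (+-identityʳ (𝟙 c))
  𝟙-∧ false c = refl

  T-ext : ∀ {a b} → (T a → T b) → (T b → T a) → a ≡ b
  T-ext {false} {false} _ _ = refl
  T-ext {false} {true}  _ g = ⊥-elim (g tt)
  T-ext {true}  {false} f _ = ⊥-elim (f tt)
  T-ext {true}  {true}  _ _ = refl

  xor-cancelˡ : ∀ m s t → m xor s ≡ m xor t → s ≡ t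
  xor-cancelˡ false s t eq = eq
  xor-cancelˡ true  s t eq = not-injective eq

  %2≢1⇒%2≡0 : ∀ m → m % 2 ≢ 1 → m % 2 ≡ 0
  %2≢1⇒%2≡0 m m%2≢1 with m % 2 | m%n<n m 2
  ... | 0           | _            = refl
  ... | 1           | _            = ⊥-elim (m%2≢1 refl)
  ... | suc (suc _) | s≤s (s≤s ())

  sumF≡sum : ∀ {n} (f : Fin n → ℕ) → sumF f ≡ sum f
  sumF≡sum {zero}  f = refl
  sumF≡sum {suc n} f = cong (f zero +_) (sumF≡sum (f ∘ suc))

  count≡∑𝟙 : ∀ {n} (p : Fin n → Bool) → count p ≡ ∑[ i < n ] 𝟙 (p i)
  count≡∑𝟙 {zero}  p = refl
  count≡∑𝟙 {suc n} p = cong (𝟙 (p zero) +_) (count≡∑𝟙 (p ∘ suc))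

  count+count-not : ∀ {n} (p : Fin n → Bool) → count p + count (not ∘ p) ≡ n
  count+count-not {zero}  p = refl
  count+count-not {suc n} p with p zero
  ... | true  = cong suc (count+count-not (p ∘ suc))
  ... | false = trans (+-suc _ _) (cong suc (count+count-not (p ∘ suc)))

  ∑-zero : ∀ {n} (f : Fin n → ℕ) → (∀ i → f i ≡ 0) → sum f ≡ 0
  ∑-zero {n} f f≡0 = trans (sum-cong-≗ f≡0) (sum-replicate-zero n)

  ≤-∑ : ∀ {n} (f : Fin n → ℕ) i → f i ≤ sum f
  ≤-∑ f zero    = m≤m+n _ _
  ≤-∑ f (suc i) = ≤-trans (≤-∑ (f ∘ suc) i) (m≤n+m _ _)

  ∑-concentrated : ∀ {n} (f : Fin n → ℕ) u → (∀ j → j ≢ u → f j ≡ 0) → sum f ≡ f u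
  ∑-concentrated {suc n} f u f≡0 = begin
    sum f                       ≡⟨ sum-remove f ⟩
    f u + sum (f ∘ punchIn u)   ≡⟨ cong (f u +_) (∑-zero (f ∘ punchIn u) (λ j → f≡0 _ (punchInᵢ≢i u j))) ⟩
    f u + 0                     ≡⟨ +-identityʳ (f u) ⟩
    f u                         ∎
    where open ≡-Reasoning

  ∑-except : ∀ {n} (f g : Fin n → ℕ) u → (∀ j → j ≢ u → f j ≡ g j) →
    sum f + g u ≡ sum g + f u
  ∑-except {suc n} f g u f≡g = begin
    sum f + g u                       ≡⟨ cong (_+ g u) (sum-remove f) ⟩
    f u + sum (f ∘ punchIn u) + g u   ≡⟨ cong (λ s → f u + s + g u) (sum-cong-≗ (λ j → f≡g _ (punchInᵢ≢i u j))) ⟩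
    f u + sum (g ∘ punchIn u) + g u   ≡⟨ solve (f u) (sum (g ∘ punchIn u)) (g u) ⟩
    g u + sum (g ∘ punchIn u) + f u   ≡⟨ cong (_+ f u) (sym (sum-remove g)) ⟩
    sum g + f u                       ∎
    where
    open ≡-Reasoning
    solve : ∀ a b c → a + b + c ≡ c + b + a
    solve = solve-∀

  ∑∑-except : ∀ {n} (f g : Fin n → Fin n → ℕ) u →
    (∀ i j → f i j ≡ f j i) → (∀ i j → g i j ≡ g j i) →
    (∀ i j → i ≢ u → j ≢ u → f i j ≡ g i j) → f u u ≡ g u u →
    ∑[ i < n ] sum (f i) + 2 * sum (g u) ≡ ∑[ i < n ] sum (g i) + 2 * sum (f u)
  ∑∑-except {n} f g u f-sym g-sym f≡g fuu≡guu = +-cancelʳ-≡ (g u u) _ _ (begin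
    ∑∑f + 2 * Rg + g u u              ≡⟨ regroup ∑∑f Rg (g u u) ⟩
    (∑∑f + Rg) + (Rg + g u u)         ≡⟨ cong₂ (λ s c → s + (Rg + c)) (sym (sum-rows f g g-sym)) (sym fuu≡guu) ⟩
    sum rowf + rowg u                 ≡⟨ ∑-except rowf rowg u rows-agree ⟩
    sum rowg + rowf u                 ≡⟨ cong₂ (λ s c → s + (Rf + c)) (sum-rows g f f-sym) refl ⟩
    (∑∑g + Rf) + (Rf + g u u)         ≡⟨ regroup ∑∑g Rf (g u u) ⟨
    ∑∑g + 2 * Rf + g u u              ∎)
    where
    open ≡-Reasoning
    ∑∑f = ∑[ i < n ] sum (f i)
    ∑∑g = ∑[ i < n ] sum (g i)
    Rf = sum (f u)
    Rg = sum (g u)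
    rowf rowg : Fin n → ℕ
    rowf i = sum (f i) + g i u
    rowg i = sum (g i) + f i u
    rows-agree : ∀ i → i ≢ u → rowf i ≡ rowg i
    rows-agree i i≢u = ∑-except (f i) (g i) u (λ j j≢u → f≡g i j i≢u j≢u)
    sum-rows : ∀ (h k : Fin n → Fin n → ℕ) → (∀ i j → k i j ≡ k j i) →
      sum (λ i → sum (h i) + k i u) ≡ ∑[ i < n ] sum (h i) + sum (k u)
    sum-rows h k k-sym = trans (∑-distrib-+ (sum ∘ h) (λ i → k i u)) (cong (_ +_) (sum-cong-≗ (λ i → k-sym i u)))
    regroup : ∀ x r c → x + 2 * r + c ≡ (x + r) + (r + c)
    regroup = solve-∀

  ∑∑-except-one : ∀ {n} (f g : Fin n → Fin n → ℕ) x y →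
    (∀ i j → ¬ (i ≡ x × j ≡ y) → f i j ≡ g i j) →
    ∑[ i < n ] sum (f i) + g x y ≡ ∑[ i < n ] sum (g i) + f x y
  ∑∑-except-one {n} f g x y f≡g = +-cancelʳ-≡ (sum (g x)) _ _ (begin
    ∑∑f + g x y + sum (g x)
      ≡⟨ shuffle ∑∑f (g x y) (sum (g x)) ⟩
    ∑∑f + sum (g x) + g x y
      ≡⟨ cong (_+ g x y) (∑-except (sum ∘ f) (sum ∘ g) x rows-agree) ⟩
    ∑∑g + sum (f x) + g x y
      ≡⟨ +-assoc ∑∑g (sum (f x)) (g x y) ⟩
    ∑∑g + (sum (f x) + g x y)
      ≡⟨ cong (∑∑g +_) (∑-except (f x) (g x) y (λ j j≢y → f≡g x j (λ (_ , j≡y) → j≢y j≡y))) ⟩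
    ∑∑g + (sum (g x) + f x y)
      ≡⟨ shuffle′ ∑∑g (sum (g x)) (f x y) ⟩
    ∑∑g + f x y + sum (g x)
      ∎)
    where
    open ≡-Reasoning
    ∑∑f = ∑[ i < n ] sum (f i)
    ∑∑g = ∑[ i < n ] sum (g i)
    rows-agree : ∀ i → i ≢ x → sum (f i) ≡ sum (g i)
    rows-agree i i≢x = sum-cong-≗ (λ j → f≡g i j (λ (i≡x , _) → i≢x i≡x))
    shuffle : ∀ a b c → a + b + c ≡ a + c + b
    shuffle = solve-∀
    shuffle′ : ∀ a b c → a + (b + c) ≡ a + c + b
    shuffle′ = solve-∀

  Bipartition : ℕ → Set
  Bipartition n = Fin n → Bool

  -- Without function extensionality, functions of a bipartition must be shown to respect ≗ separately.
  RespectsPointwise : ∀ {n} {A : Set} → (Bipartition n → A) → Set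
  RespectsPointwise f = ∀ {σ τ} → σ ≗ τ → f σ ≡ f τ

  sumBip : ∀ n → (Bipartition n → ℕ) → ℕ
  sumBip zero    f = f (λ ())
  sumBip (suc n) f = sumBip n (λ σ → f (true ∷ σ)) + sumBip n (λ σ → f (false ∷ σ))

  countBip≡sumBip : ∀ n P → countBip n P ≡ sumBip n (𝟙 ∘ P)
  countBip≡sumBip zero    P = refl
  countBip≡sumBip (suc n) P = cong₂ _+_ (countBip≡sumBip n _) (countBip≡sumBip n _)

  sumBip-cong : ∀ n {f g : Bipartition n → ℕ} → (∀ σ → f σ ≡ g σ) → sumBip n f ≡ sumBip n g
  sumBip-cong zero    f≡g = f≡g _
  sumBip-cong (suc n) f≡g = cong₂ _+_ (sumBip-cong n (f≡g ∘ (true ∷_))) (sumBip-cong n (f≡g ∘ (false ∷_)))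

  countBip-cong : ∀ n {P Q : Bipartition n → Bool} → (∀ σ → P σ ≡ Q σ) → countBip n P ≡ countBip n Q
  countBip-cong n {P} {Q} P≡Q = begin
    countBip n P         ≡⟨ countBip≡sumBip n P ⟩
    sumBip n (𝟙 ∘ P)     ≡⟨ sumBip-cong n (cong 𝟙 ∘ P≡Q) ⟩
    sumBip n (𝟙 ∘ Q)     ≡⟨ countBip≡sumBip n Q ⟨
    countBip n Q         ∎
    where open ≡-Reasoning

  sumBip-distrib-+ : ∀ n (f g : Bipartition n → ℕ) →
    sumBip n (λ σ → f σ + g σ) ≡ sumBip n f + sumBip n g
  sumBip-distrib-+ zero    f g = refl
  sumBip-distrib-+ (suc n) f g = trans
    (cong₂ _+_ (sumBip-distrib-+ n _ _) (sumBip-distrib-+ n _ _))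
    (interchange (sumBip n (f ∘ (true ∷_))) (sumBip n (g ∘ (true ∷_))) _ _)
    where
    interchange : ∀ a b c d → a + b + (c + d) ≡ a + c + (b + d)
    interchange = solve-∀

  sumBip-∑-comm : ∀ n {m} (f : Fin m → Bipartition n → ℕ) →
    sumBip n (λ σ → ∑[ i < m ] f i σ) ≡ ∑[ i < m ] sumBip n (f i)
  sumBip-∑-comm zero    f = refl
  sumBip-∑-comm (suc n) f = trans
    (cong₂ _+_ (sumBip-∑-comm n (λ i → f i ∘ (true ∷_))) (sumBip-∑-comm n (λ i → f i ∘ (false ∷_))))
    (sym (∑-distrib-+ (λ i → sumBip n (f i ∘ (true ∷_))) (λ i → sumBip n (f i ∘ (false ∷_)))))

  sumBip-≤ : ∀ n k (f : Bipartition n → ℕ) → (∀ σ → f σ ≤ k) → sumBip n f ≤ k * 2 ^ n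
  sumBip-≤ zero    k f f≤k = subst (f (λ ()) ≤_) (sym (*-identityʳ k)) (f≤k (λ ()))
  sumBip-≤ (suc n) k f f≤k = subst (sumBip (suc n) f ≤_) (double k (2 ^ n))
    (+-mono-≤ (sumBip-≤ n k _ (f≤k ∘ (true ∷_))) (sumBip-≤ n k _ (f≤k ∘ (false ∷_))))
    where
    double : ∀ k p → k * p + k * p ≡ k * (2 * p)
    double = solve-∀

  _⊕_ : ∀ {n} → Bipartition n → Bipartition n → Bipartition n
  (m ⊕ σ) i = m i xor σ i

  sumBip-⊕ : ∀ n (f : Bipartition n → ℕ) (m : Bipartition n) → RespectsPointwise f →
    sumBip n (λ σ → f (m ⊕ σ)) ≡ sumBip n f
  sumBip-⊕ zero    f m f-resp = f-resp (λ ())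
  sumBip-⊕ (suc n) f m f-resp = trans
    (cong₂ _+_ (shift true) (shift false)) (swap-halves (m zero))
    where
    half : Bool → Bipartition n → ℕ
    half b σ = f (b ∷ σ)
    shift : ∀ b → sumBip n (λ σ → f (m ⊕ (b ∷ σ))) ≡ sumBip n (half (m zero xor b))
    shift b = trans (sumBip-cong n (λ σ → f-resp (λ { zero → refl ; (suc i) → refl })))
      (sumBip-⊕ n (half (m zero xor b)) (m ∘ suc) (λ σ≗τ → f-resp (λ { zero → refl ; (suc i) → σ≗τ i })))
    swap-halves : ∀ c → sumBip n (half (c xor true)) + sumBip n (half (c xor false))
                      ≡ sumBip n (half true) + sumBip n (half false)
    swap-halves false = refl
    swap-halves true  = +-comm (sumBip n (half false)) _

  countBip-⊕ : ∀ n (P : Bipartition n → Bool) (m : Bipartition n) → RespectsPointwise P →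
    countBip n (λ σ → P (m ⊕ σ)) ≡ countBip n P
  countBip-⊕ n P m P-resp = begin
    countBip n (λ σ → P (m ⊕ σ))       ≡⟨ countBip≡sumBip n _ ⟩
    sumBip n (λ σ → 𝟙 (P (m ⊕ σ)))     ≡⟨ sumBip-⊕ n (𝟙 ∘ P) m (cong 𝟙 ∘ P-resp) ⟩
    sumBip n (𝟙 ∘ P)                   ≡⟨ countBip≡sumBip n P ⟨
    countBip n P                       ∎
    where open ≡-Reasoning

  countBip-split : ∀ n (p R : Bipartition n → Bool) →
    countBip n (λ σ → p σ ∧ R σ) + countBip n (λ σ → not (p σ) ∧ R σ) ≡ countBip n R
  countBip-split n p R = begin
    countBip n (λ σ → p σ ∧ R σ) + countBip n (λ σ → not (p σ) ∧ R σ)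
      ≡⟨ cong₂ _+_ (countBip≡sumBip n _) (countBip≡sumBip n _) ⟩
    sumBip n (λ σ → 𝟙 (p σ ∧ R σ)) + sumBip n (λ σ → 𝟙 (not (p σ) ∧ R σ))
      ≡⟨ sumBip-distrib-+ n _ _ ⟨
    sumBip n (λ σ → 𝟙 (p σ ∧ R σ) + 𝟙 (not (p σ) ∧ R σ))
      ≡⟨ sumBip-cong n (λ σ → either-side (p σ) (R σ)) ⟩
    sumBip n (𝟙 ∘ R)
      ≡⟨ countBip≡sumBip n R ⟨
    countBip n R
      ∎
    where
    open ≡-Reasoning
    either-side : ∀ b r → 𝟙 (b ∧ r) + 𝟙 (not b ∧ r) ≡ 𝟙 r
    either-side true  r = +-identityʳ (𝟙 r)
    either-side false r = refl

  ∑𝟙≤ : ∀ {m} (b : Fin m → Bool) → ∑[ r < m ] 𝟙 (b r) ≤ m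
  ∑𝟙≤ {zero}  b = z≤n
  ∑𝟙≤ {suc m} b with b zero
  ... | true  = s≤s (∑𝟙≤ (b ∘ suc))
  ... | false = m≤n⇒m≤1+n (∑𝟙≤ (b ∘ suc))

  ∑𝟙<-not-all : ∀ {m} (b : Fin m → Bool) → ¬ (∀ r → T (b r)) → ∑[ r < m ] 𝟙 (b r) < m
  ∑𝟙<-not-all {zero}  b not-all = ⊥-elim (not-all (λ ()))
  ∑𝟙<-not-all {suc m} b not-all with b zero in b₀
  ... | false = s≤s (∑𝟙≤ (b ∘ suc))
  ... | true  = s≤s (∑𝟙<-not-all (b ∘ suc) λ all-suc → not-all λ where
                      zero    → subst T (sym b₀) tt
                      (suc r) → all-suc r)

  countBip-not-all : ∀ n {m} (P : Fin (suc m) → Bipartition n → Bool) →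
    (∀ σ → ¬ (∀ r → T (P r σ))) → ∑[ r < suc m ] countBip n (P r) ≤ m * 2 ^ n
  countBip-not-all n {m} P not-all = begin
    ∑[ r < suc m ] countBip n (P r)
      ≡⟨ sum-cong-≗ (λ r → countBip≡sumBip n (P r)) ⟩
    ∑[ r < suc m ] sumBip n (𝟙 ∘ P r)
      ≡⟨ sumBip-∑-comm n (λ r → 𝟙 ∘ P r) ⟨
    sumBip n (λ σ → ∑[ r < suc m ] 𝟙 (P r σ))
      ≤⟨ sumBip-≤ n m _ (λ σ → s≤s⁻¹ (∑𝟙<-not-all (λ r → P r σ) (not-all σ))) ⟩
    m * 2 ^ n
      ∎
    where open ≤-Reasoning

  countBip-none : ∀ n (P : Bipartition n → Bool) → (∀ σ → ¬ T (P σ)) → countBip n P ≡ 0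
  countBip-none n P none = n≤0⇒n≡0 (subst (_≤ 0) (sym (countBip≡sumBip n P))
    (sumBip-≤ n 0 (𝟙 ∘ P) (λ σ → ≤-reflexive (𝟙-false (none σ)))))

  -- Cuts of a Boolean adjacency relation

  Adjacency : ℕ → Set
  Adjacency n = Fin n → Fin n → Bool

  SymmetricAdj : ∀ {n} → Adjacency n → Set
  SymmetricAdj a = ∀ i j → a i j ≡ a j i

  -- `crosses` counts each edge once, so that `cut (adj G)` is `cutSize G` by definition; `crossing` is its
  -- symmetric version on ordered pairs.
  crossing : ∀ {n} → Adjacency n → Bipartition n → Fin n → Fin n → Bool
  crossing a σ i j = a i j ∧ (σ i xor σ j)

  crosses : ∀ {n} → Adjacency n → Bipartition n → Fin n → Fin n → Bool
  crosses a σ i j = (toℕ i <ᵇ toℕ j) ∧ crossing a σ i j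

  cut : ∀ {n} → Adjacency n → Bipartition n → ℕ
  cut a σ = sumF (λ i → count (crosses a σ i))

  cut≡∑∑ : ∀ {n} (a : Adjacency n) σ → cut a σ ≡ ∑[ i < n ] ∑[ j < n ] 𝟙 (crosses a σ i j)
  cut≡∑∑ a σ =
    trans (sumF≡sum (λ i → count (crosses a σ i))) (sum-cong-≗ (λ i → count≡∑𝟙 (crosses a σ i)))

  cut-cong : ∀ {n} (a : Adjacency n) → RespectsPointwise (cut a)
  cut-cong a {σ} {τ} σ≗τ = trans (cut≡∑∑ a σ) (trans
    (sum-cong-≗ λ i → sum-cong-≗ λ j →
       cong (λ c → 𝟙 ((toℕ i <ᵇ toℕ j) ∧ a i j ∧ c)) (cong₂ _xor_ (σ≗τ i) (σ≗τ j)))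
    (sym (cut≡∑∑ a τ)))

  <ᵇ-true : ∀ {m n} → m < n → (m <ᵇ n) ≡ true
  <ᵇ-true m<n = Equivalence.to T-≡ (<⇒<ᵇ m<n)

  <ᵇ-false : ∀ {m n} → n ≤ m → (m <ᵇ n) ≡ false
  <ᵇ-false {m} {n} n≤m with m <ᵇ n in eq
  ... | false = refl
  ... | true  = ⊥-elim (≤⇒≯ n≤m (<ᵇ⇒< m n (subst T (sym eq) tt)))

  ConstantOnEdges : ∀ {n} → Adjacency n → Bipartition n → Set
  ConstantOnEdges a σ = ∀ i j → T (a i j) → σ i ≡ σ j

  crossing-false : ∀ {n} (a : Adjacency n) σ {i j} → (T (a i j) → σ i ≡ σ j) → crossing a σ i j ≡ false
  crossing-false a σ {i} {j} const with a i j
  ... | false = refl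
  ... | true  = trans (cong (σ i xor_) (sym (const tt))) (xor-same (σ i))

  constant⇒cut≡0 : ∀ {n} (a : Adjacency n) σ → ConstantOnEdges a σ → cut a σ ≡ 0
  constant⇒cut≡0 a σ const = trans (cut≡∑∑ a σ)
    (∑-zero _ λ i → ∑-zero (λ j → 𝟙 (crosses a σ i j)) λ j →
      trans (cong (λ c → 𝟙 ((toℕ i <ᵇ toℕ j) ∧ c)) (crossing-false a σ (const i j)))
            (cong 𝟙 (∧-zeroʳ (toℕ i <ᵇ toℕ j))))

  crosses≤cut : ∀ {n} (a : Adjacency n) σ i j → 𝟙 (crosses a σ i j) ≤ cut a σ
  crosses≤cut {n} a σ i j = subst (𝟙 (crosses a σ i j) ≤_) (sym (cut≡∑∑ a σ))
    (≤-trans (≤-∑ (λ j → 𝟙 (crosses a σ i j)) j) (≤-∑ (λ i → ∑[ j < n ] 𝟙 (crosses a σ i j)) i))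

  crosses-edge : ∀ {n} (a : Adjacency n) σ {i j} → toℕ i < toℕ j → T (a i j) → crosses a σ i j ≡ (σ i xor σ j)
  crosses-edge a σ i<j aij rewrite <ᵇ-true i<j | Equivalence.to T-≡ aij = refl

  𝟙-xor≤0 : ∀ x y → 𝟙 (x xor y) ≤ 0 → x ≡ y
  𝟙-xor≤0 false false _ = refl
  𝟙-xor≤0 true  true  _ = refl

  cut≡0⇒ordered-edge-constant : ∀ {n} (a : Adjacency n) σ → cut a σ ≡ 0 →
    ∀ {i j} → toℕ i < toℕ j → T (a i j) → σ i ≡ σ j
  cut≡0⇒ordered-edge-constant a σ cut≡0 {i} {j} i<j aij = 𝟙-xor≤0 (σ i) (σ j)
    (subst₂ _≤_ (cong 𝟙 (crosses-edge a σ i<j aij)) cut≡0 (crosses≤cut a σ i j))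

  cut≡0⇒constant : ∀ {n} (a : Adjacency n) → SymmetricAdj a → ∀ σ → cut a σ ≡ 0 → ConstantOnEdges a σ
  cut≡0⇒constant a sym-a σ cut≡0 i j aij with <-cmp i j
  ... | tri< i<j _ _  = cut≡0⇒ordered-edge-constant a σ cut≡0 i<j aij
  ... | tri> _ _ j<i  = sym (cut≡0⇒ordered-edge-constant a σ cut≡0 j<i (subst T (sym-a i j) aij))
  ... | tri≈ _ refl _ = refl

  constant-on-walks : ∀ {n} (a : Adjacency n) σ → ConstantOnEdges a σ → ∀ {i j} → Reach a i j → σ i ≡ σ j
  constant-on-walks a σ const here                 = refl
  constant-on-walks a σ const (step {i} {k} ik kj) = trans (const i k ik) (constant-on-walks a σ const kj)

  cut≡ᵇ0-⊕ : ∀ {n} (a : Adjacency n) → SymmetricAdj a → ∀ {m} → ConstantOnEdges a m → ∀ σ →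
    (cut a (m ⊕ σ) ≡ᵇ 0) ≡ (cut a σ ≡ᵇ 0)
  cut≡ᵇ0-⊕ a sym-a {m} m-const σ = T-ext to from
    where
    to : T (cut a (m ⊕ σ) ≡ᵇ 0) → T (cut a σ ≡ᵇ 0)
    to cut≡0 = ≡⇒≡ᵇ _ 0 (constant⇒cut≡0 a σ λ i j ij → xor-cancelˡ (m i) (σ i) (σ j)
      (trans (cut≡0⇒constant a sym-a (m ⊕ σ) (≡ᵇ⇒≡ _ 0 cut≡0) i j ij)
             (cong (_xor σ j) (sym (m-const i j ij)))))
    from : T (cut a σ ≡ᵇ 0) → T (cut a (m ⊕ σ) ≡ᵇ 0)
    from cut≡0 = ≡⇒≡ᵇ _ 0 (constant⇒cut≡0 a (m ⊕ σ) λ i j ij →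
      cong₂ _xor_ (m-const i j ij) (cut≡0⇒constant a sym-a σ (≡ᵇ⇒≡ _ 0 cut≡0) i j ij))

  crossing-sym : ∀ {n} (a : Adjacency n) → SymmetricAdj a → ∀ σ i j → crossing a σ i j ≡ crossing a σ j i
  crossing-sym a sym-a σ i j = cong₂ _∧_ (sym-a i j) (xor-comm (σ i) (σ j))

  crossing≡crosses+crosses : ∀ {n} (a : Adjacency n) → SymmetricAdj a → ∀ σ i j →
    𝟙 (crossing a σ i j) ≡ 𝟙 (crosses a σ i j) + 𝟙 (crosses a σ j i)
  crossing≡crosses+crosses a sym-a σ i j with <-cmp i j
  ... | tri< i<j _ _ rewrite <ᵇ-true i<j | <ᵇ-false (<⇒≤ i<j) = sym (+-identityʳ _)
  ... | tri> _ _ j<i rewrite <ᵇ-true j<i | <ᵇ-false (<⇒≤ j<i) = cong 𝟙 (crossing-sym a sym-a σ i j)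
  ... | tri≈ _ refl _ rewrite crossing-false a σ {i} {i} (λ _ → refl) | ∧-zeroʳ (toℕ i <ᵇ toℕ i) = refl

  ∑∑crossing≡cut+cut : ∀ {n} (a : Adjacency n) → SymmetricAdj a → ∀ σ →
    ∑[ i < n ] ∑[ j < n ] 𝟙 (crossing a σ i j) ≡ cut a σ + cut a σ
  ∑∑crossing≡cut+cut {n} a sym-a σ = begin
    ∑[ i < n ] ∑[ j < n ] 𝟙 (crossing a σ i j)
      ≡⟨ sum-cong-≗ (λ i → trans (sum-cong-≗ (crossing≡crosses+crosses a sym-a σ i))
                                 (∑-distrib-+ (X i) (Xᵀ i))) ⟩
    ∑[ i < n ] (∑[ j < n ] 𝟙 (crosses a σ i j) + ∑[ j < n ] 𝟙 (crosses a σ j i))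
      ≡⟨ ∑-distrib-+ (sum ∘ X) (sum ∘ Xᵀ) ⟩
    ∑[ i < n ] ∑[ j < n ] 𝟙 (crosses a σ i j) + ∑[ i < n ] ∑[ j < n ] 𝟙 (crosses a σ j i)
      ≡⟨ cong (sum (sum ∘ X) +_) (∑-comm Xᵀ) ⟩
    ∑[ i < n ] ∑[ j < n ] 𝟙 (crosses a σ i j) + ∑[ j < n ] ∑[ i < n ] 𝟙 (crosses a σ j i)
      ≡⟨ cong₂ _+_ (cut≡∑∑ a σ) (cut≡∑∑ a σ) ⟨
    cut a σ + cut a σ
      ∎
    where
    open ≡-Reasoning
    X Xᵀ : Fin n → Fin n → ℕ
    X  i j = 𝟙 (crosses a σ i j)
    Xᵀ i j = 𝟙 (crosses a σ j i)

  -- Toggling one vertex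

  toggle : ∀ {n} → Fin n → Bipartition n → Bipartition n
  toggle u σ = updateAt σ u not

  toggle-off : ∀ {n} (u : Fin n) σ {i} → i ≢ u → toggle u σ i ≡ σ i
  toggle-off u σ {i} i≢u = updateAt-minimal i u σ i≢u

  toggle-cong : ∀ {n} (u : Fin n) {σ τ} → σ ≗ τ → toggle u σ ≗ toggle u τ
  toggle-cong u {σ} {τ} σ≗τ i with i ≟ u
  ... | yes refl = trans (updateAt-updates u σ) (trans (cong not (σ≗τ u)) (sym (updateAt-updates u τ)))
  ... | no  i≢u  = trans (toggle-off u σ i≢u) (trans (σ≗τ i) (sym (toggle-off u τ i≢u)))

  toggle≗⊕ : ∀ {n} (u : Fin n) σ → toggle u σ ≗ (toggle u (λ _ → false) ⊕ σ)
  toggle≗⊕ u σ i with i ≟ u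
  ... | yes refl = trans (updateAt-updates u σ) (cong (_xor σ u) (sym (updateAt-updates u (λ _ → false))))
  ... | no  i≢u  = trans (toggle-off u σ i≢u) (cong (_xor σ i) (sym (toggle-off u (λ _ → false) i≢u)))

  countBip-toggle : ∀ n (P : Bipartition n → Bool) u → RespectsPointwise P →
    countBip n (P ∘ toggle u) ≡ countBip n P
  countBip-toggle n P u P-resp =
    trans (countBip-cong n (λ σ → P-resp (toggle≗⊕ u σ))) (countBip-⊕ n P (toggle u (λ _ → false)) P-resp)

  toggle-invariant⇒constant : ∀ {n} {A : Set} (Φ : Bipartition n → A) → RespectsPointwise Φ →
    (∀ u σ → Φ (toggle u σ) ≡ Φ σ) → ∀ σ → Φ σ ≡ Φ (λ _ → false)
  toggle-invariant⇒constant {zero}  Φ Φ-resp Φ-inv σ = Φ-resp (λ ())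
  toggle-invariant⇒constant {suc n} Φ Φ-resp Φ-inv σ = begin
    Φ σ                         ≡⟨ Φ-resp (λ { zero → refl ; (suc i) → refl }) ⟩
    Φ (σ zero ∷ σ ∘ suc)        ≡⟨ head-to-false (σ zero) ⟩
    Φ (false ∷ σ ∘ suc)         ≡⟨ toggle-invariant⇒constant (Φ ∘ (false ∷_)) tail-resp tail-inv (σ ∘ suc) ⟩
    Φ (false ∷ (λ _ → false))   ≡⟨ Φ-resp (λ { zero → refl ; (suc i) → refl }) ⟩
    Φ (λ _ → false)             ∎
    where
    open ≡-Reasoning
    head-to-false : ∀ b → Φ (b ∷ σ ∘ suc) ≡ Φ (false ∷ σ ∘ suc)
    head-to-false false = refl
    head-to-false true  = trans (sym (Φ-inv zero (true ∷ σ ∘ suc))) (Φ-resp (λ { zero → refl ; (suc i) → refl }))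
    tail-resp : RespectsPointwise (Φ ∘ (false ∷_))
    tail-resp σ≗τ = Φ-resp (λ { zero → refl ; (suc i) → σ≗τ i })
    tail-inv : ∀ u τ → Φ (false ∷ toggle u τ) ≡ Φ (false ∷ τ)
    tail-inv u τ = trans (Φ-resp (λ { zero → refl ; (suc i) → refl })) (Φ-inv (suc u) (false ∷ τ))

  module _ {n} (G : Graph n) where

    crossDegree : Bipartition n → Fin n → ℕ
    crossDegree σ u = ∑[ j < n ] 𝟙 (crossing (adj G) σ u j)

    crossDegree-toggle : ∀ σ u → crossDegree (toggle u σ) u + crossDegree σ u ≡ deg G u
    crossDegree-toggle σ u = begin
      crossDegree (toggle u σ) u + crossDegree σ u
        ≡⟨ ∑-distrib-+ (λ j → 𝟙 (crossing (adj G) (toggle u σ) u j)) (λ j → 𝟙 (crossing (adj G) σ u j)) ⟨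
      ∑[ j < n ] (𝟙 (crossing (adj G) (toggle u σ) u j) + 𝟙 (crossing (adj G) σ u j))
        ≡⟨ sum-cong-≗ pointwise ⟩
      ∑[ j < n ] 𝟙 (adj G u j)
        ≡⟨ count≡∑𝟙 (adj G u) ⟨
      deg G u
        ∎
      where
      open ≡-Reasoning
      complementary : ∀ e x y → 𝟙 (e ∧ (not x xor y)) + 𝟙 (e ∧ (x xor y)) ≡ 𝟙 e
      complementary false x     y     = refl
      complementary true  false false = refl
      complementary true  false true  = refl
      complementary true  true  false = refl
      complementary true  true  true  = refl
      pointwise : ∀ j → 𝟙 (crossing (adj G) (toggle u σ) u j) + 𝟙 (crossing (adj G) σ u j) ≡ 𝟙 (adj G u j)
      pointwise j with j ≟ u
      ... | yes refl rewrite crossing-false (adj G) (toggle u σ) {u} {u} (λ _ → refl)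
                           | crossing-false (adj G) σ {u} {u} (λ _ → refl) | irrefl G u = refl
      ... | no  j≢u  rewrite updateAt-updates u {not} σ | toggle-off u σ j≢u = complementary (adj G u j) (σ u) (σ j)

    -- After doubling, both cuts become symmetric double sums of `crossing`, which differ only in row and column u.
    cut-toggle : ∀ σ u → cut (adj G) (toggle u σ) + crossDegree σ u * 2 ≡ cut (adj G) σ + deg G u
    cut-toggle σ u = *-cancelˡ-≡ _ _ 2 (begin
      2 * (cτ + Rσ * 2)
        ≡⟨ regroup cτ Rσ ⟩
      (cτ + cτ) + 2 * Rσ + 2 * Rσ
        ≡⟨ cong (λ s → s + 2 * Rσ + 2 * Rσ) (∑∑crossing≡cut+cut (adj G) (Graph.sym G) τ) ⟨
      ∑∑ τ + 2 * Rσ + 2 * Rσ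
        ≡⟨ cong (_+ 2 * Rσ) (∑∑-except (X τ) (X σ) u (X-sym τ) (X-sym σ) off-u (diag)) ⟩
      ∑∑ σ + 2 * Rτ + 2 * Rσ
        ≡⟨ cong (λ s → s + 2 * Rτ + 2 * Rσ) (∑∑crossing≡cut+cut (adj G) (Graph.sym G) σ) ⟩
      (cσ + cσ) + 2 * Rτ + 2 * Rσ
        ≡⟨ collect cσ Rτ Rσ ⟩
      2 * (cσ + (Rτ + Rσ))
        ≡⟨ cong (λ d → 2 * (cσ + d)) (crossDegree-toggle σ u) ⟩
      2 * (cσ + deg G u)
        ∎)
      where
      open ≡-Reasoning
      τ = toggle u σ
      X : Bipartition n → Fin n → Fin n → ℕ
      X ρ i j = 𝟙 (crossing (adj G) ρ i j)
      ∑∑ : Bipartition n → ℕ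
      ∑∑ ρ = ∑[ i < n ] ∑[ j < n ] X ρ i j
      cτ = cut (adj G) τ
      cσ = cut (adj G) σ
      Rτ = crossDegree τ u
      Rσ = crossDegree σ u
      X-sym : ∀ ρ i j → X ρ i j ≡ X ρ j i
      X-sym ρ i j = cong 𝟙 (crossing-sym (adj G) (Graph.sym G) ρ i j)
      off-u : ∀ i j → i ≢ u → j ≢ u → X τ i j ≡ X σ i j
      off-u i j i≢u j≢u rewrite toggle-off u σ i≢u | toggle-off u σ j≢u = refl
      diag : X τ u u ≡ X σ u u
      diag = cong 𝟙 (trans (crossing-false (adj G) τ (λ _ → refl)) (sym (crossing-false (adj G) σ (λ _ → refl))))
      regroup : ∀ c r → 2 * (c + r * 2) ≡ (c + c) + 2 * r + 2 * r
      regroup = solve-∀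
      collect : ∀ c r s → (c + c) + 2 * r + 2 * s ≡ 2 * (c + (r + s))
      collect = solve-∀

    balanced-toggle : ∀ σ u → cut (adj G) (toggle u σ) ≡ cut (adj G) σ → crossDegree σ u * 2 ≡ deg G u
    balanced-toggle σ u same-cut =
      +-cancelˡ-≡ (cut (adj G) σ) _ _ (trans (cong (_+ crossDegree σ u * 2) (sym same-cut)) (cut-toggle σ u))

    crossDegree-toggle-neighbour : ∀ σ {u v} → T (adj G u v) → crossDegree (toggle v σ) u ≢ crossDegree σ u
    crossDegree-toggle-neighbour σ {u} {v} uv Rρ≡Rσ = flipped-differs (σ u) (σ v) (begin
      𝟙 (σ u xor σ v)          ≡⟨ X-at-v σ refl ⟨
      X σ v                    ≡⟨ +-cancelˡ-≡ (crossDegree σ u) _ _ sums ⟩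
      X ρ v                    ≡⟨ X-at-v ρ (toggle-off v σ u≢v) ⟩
      𝟙 (σ u xor ρ v)          ≡⟨ cong (λ b → 𝟙 (σ u xor b)) (updateAt-updates v σ) ⟩
      𝟙 (σ u xor not (σ v))    ∎)
      where
      open ≡-Reasoning
      ρ = toggle v σ
      X : Bipartition n → Fin n → ℕ
      X τ j = 𝟙 (crossing (adj G) τ u j)
      u≢v : u ≢ v
      u≢v refl = subst T (irrefl G u) uv
      X-at-v : ∀ τ → τ u ≡ σ u → X τ v ≡ 𝟙 (σ u xor τ v)
      X-at-v τ τu≡σu rewrite Equivalence.to T-≡ uv | τu≡σu = refl
      agree-off-v : ∀ j → j ≢ v → X ρ j ≡ X σ j
      agree-off-v j j≢v rewrite toggle-off v σ u≢v | toggle-off v σ j≢v = refl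
      sums : crossDegree σ u + X σ v ≡ crossDegree σ u + X ρ v
      sums = trans (cong (_+ X σ v) (sym Rρ≡Rσ)) (∑-except (X ρ) (X σ) v agree-off-v)
      flipped-differs : ∀ x y → 𝟙 (x xor y) ≢ 𝟙 (x xor not y)
      flipped-differs false false ()
      flipped-differs false true  ()
      flipped-differs true  false ()
      flipped-differs true  true  ()

    cutIs : ℕ → Bipartition n → Bool
    cutIs k σ = cut (adj G) σ ≡ᵇ k

    cutIs-resp : ∀ k → RespectsPointwise (cutIs k)
    cutIs-resp k σ≗τ = cong (_≡ᵇ k) (cut-cong (adj G) σ≗τ)

    cutIs-toggle-count : ∀ k u → countBip n (cutIs k ∘ toggle u) ≡ cutCount G k
    cutIs-toggle-count k u = countBip-toggle n (cutIs k) u (cutIs-resp k)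

    cutIs⇒≡ : ∀ {k} σ → T (cutIs k σ) → cut (adj G) σ ≡ k
    cutIs⇒≡ {k} σ = ≡ᵇ⇒≡ (cut (adj G) σ) k

    cutCount-odd-degree : ∀ u → deg G u % 2 ≡ 1 → ∀ k → cutCount G k * 2 ≤ 1 * 2 ^ n
    cutCount-odd-degree u odd k = subst (_≤ 1 * 2 ^ n) counts
      (countBip-not-all n pair λ σ both → 0≢1+n (begin
        0                                  ≡⟨ m*n%n≡0 (crossDegree σ u) 2 ⟨
        crossDegree σ u * 2 % 2            ≡⟨ cong (_% 2) (balanced-toggle σ u (same-cut σ (both 0F) (both 1F))) ⟩
        deg G u % 2                        ≡⟨ odd ⟩
        1                                  ∎))
      where
      open ≡-Reasoning
      pair : Fin 2 → Bipartition n → Bool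
      pair = cutIs k ∷ (cutIs k ∘ toggle u) ∷ []
      same-cut : ∀ σ → T (cutIs k σ) → T (cutIs k (toggle u σ)) → cut (adj G) (toggle u σ) ≡ cut (adj G) σ
      same-cut σ p q = trans (cutIs⇒≡ (toggle u σ) q) (sym (cutIs⇒≡ σ p))
      counts : countBip n (cutIs k) + (countBip n (cutIs k ∘ toggle u) + 0) ≡ cutCount G k * 2
      counts rewrite cutIs-toggle-count k u = twice (cutCount G k)
        where
        twice : ∀ c → c + (c + 0) ≡ c * 2
        twice = solve-∀

    even-degrees⇒even-cut : (∀ u → deg G u % 2 ≡ 0) → ∀ σ → cut (adj G) σ % 2 ≡ 0
    even-degrees⇒even-cut even σ =
      trans (toggle-invariant⇒constant (λ τ → cut (adj G) τ % 2) (cong (_% 2) ∘ cut-cong (adj G)) parity-invariant σ)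
            (cong (_% 2) (constant⇒cut≡0 (adj G) (λ _ → false) (λ _ _ _ → refl)))
      where
      parity-invariant : ∀ u σ → cut (adj G) (toggle u σ) % 2 ≡ cut (adj G) σ % 2
      parity-invariant u σ = begin
        cτ % 2                          ≡⟨ [m+kn]%n≡m%n cτ (crossDegree σ u) 2 ⟨
        (cτ + crossDegree σ u * 2) % 2  ≡⟨ cong (_% 2) (cut-toggle σ u) ⟩
        (cσ + deg G u) % 2              ≡⟨ %-distribˡ-+ cσ (deg G u) 2 ⟩
        (cσ % 2 + deg G u % 2) % 2      ≡⟨ cong (λ d → (cσ % 2 + d) % 2) (even u) ⟩
        (cσ % 2 + 0) % 2                ≡⟨ cong (_% 2) (+-identityʳ (cσ % 2)) ⟩
        cσ % 2 % 2                      ≡⟨ m%n%n≡m%n cσ 2 ⟩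
        cσ % 2                          ∎
        where
        open ≡-Reasoning
        cτ = cut (adj G) (toggle u σ)
        cσ = cut (adj G) σ

    cutCount-odd : ∀ k → k % 2 ≡ 1 → cutCount G k * 2 ≤ 1 * 2 ^ n
    cutCount-odd k k-odd with any? (λ u → deg G u % 2 ≟ℕ 1)
    ... | yes (u , u-odd) = cutCount-odd-degree u u-odd k
    ... | no  no-odd      = subst (λ c → c * 2 ≤ 1 * 2 ^ n) (sym (countBip-none n (cutIs k) no-cut-k)) z≤n
      where
      no-cut-k : ∀ σ → ¬ T (cutIs k σ)
      no-cut-k σ cut≡k = 0≢1+n (begin
        0                     ≡⟨ even-degrees⇒even-cut (λ u → %2≢1⇒%2≡0 (deg G u) (λ odd → no-odd (u , odd))) σ ⟨
        cut (adj G) σ % 2     ≡⟨ cong (_% 2) (cutIs⇒≡ σ cut≡k) ⟩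
        k % 2                 ≡⟨ k-odd ⟩
        1                     ∎)
        where open ≡-Reasoning

    cutCount2-bound : cutCount G 2 * 4 ≤ 3 * 2 ^ n
    cutCount2-bound with any? (λ u → any? (λ v → T? (adj G u v)))
    ... | no no-edge = subst (λ c → c * 4 ≤ 3 * 2 ^ n) (sym (countBip-none n (cutIs 2) no-cut-2)) z≤n
      where
      no-cut-2 : ∀ σ → ¬ T (cutIs 2 σ)
      no-cut-2 σ cut≡2 = 0≢1+n (trans
        (sym (constant⇒cut≡0 (adj G) σ (λ i j ij → ⊥-elim (no-edge (i , j , ij))))) (cutIs⇒≡ σ cut≡2))
    ... | yes (u , v , uv) = subst (_≤ 3 * 2 ^ n) counts (countBip-not-all n square not-all)
      where
      moves : Fin 4 → Bipartition n → Bipartition n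
      moves = id ∷ toggle u ∷ toggle v ∷ (toggle u ∘ toggle v) ∷ []
      square : Fin 4 → Bipartition n → Bool
      square r = cutIs 2 ∘ moves r
      not-all : ∀ σ → ¬ (∀ r → T (square r σ))
      not-all σ all-2 = crossDegree-toggle-neighbour σ uv (*-cancelʳ-≡ _ _ 2 (begin
        crossDegree (toggle v σ) u * 2   ≡⟨ balanced-toggle (toggle v σ) u (same-cut 3F 2F) ⟩
        deg G u                          ≡⟨ balanced-toggle σ u (same-cut 1F 0F) ⟨
        crossDegree σ u * 2              ∎))
        where
        open ≡-Reasoning
        same-cut : ∀ r s → cut (adj G) (moves r σ) ≡ cut (adj G) (moves s σ)
        same-cut r s = trans (cutIs⇒≡ (moves r σ) (all-2 r)) (sym (cutIs⇒≡ (moves s σ) (all-2 s)))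
      count-each : ∀ r → countBip n (square r) ≡ cutCount G 2
      count-each 0F = refl
      count-each 1F = cutIs-toggle-count 2 u
      count-each 2F = cutIs-toggle-count 2 v
      count-each 3F =
        trans (countBip-toggle n (cutIs 2 ∘ toggle u) v (cutIs-resp 2 ∘ toggle-cong u)) (cutIs-toggle-count 2 u)
      counts : ∑[ r < 4 ] countBip n (square r) ≡ cutCount G 2 * 4
      counts = trans (sum-cong-≗ count-each) (four-times (cutCount G 2))
        where
        four-times : ∀ c → c + (c + (c + (c + 0))) ≡ c * 4
        four-times = solve-∀

  -- Walks and connected components

  Reach-trans : ∀ {n} {a : Adjacency n} {i j k} → Reach a i j → Reach a j k → Reach a i k
  Reach-trans here         jk = jk
  Reach-trans (step im mj) jk = step im (Reach-trans mj jk)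

  Reach-sym : ∀ {n} {a : Adjacency n} → SymmetricAdj a → ∀ {i j} → Reach a i j → Reach a j i
  Reach-sym sym-a here                 = here
  Reach-sym sym-a (step {i} {m} im mj) = Reach-trans (Reach-sym sym-a mj) (step (subst T (sym-a i m) im) here)

  Reach-mono : ∀ {n} {a b : Adjacency n} → (∀ i j → T (a i j) → T (b i j)) →
    ∀ {i j} → Reach a i j → Reach b i j
  Reach-mono a⊆b here         = here
  Reach-mono a⊆b (step im mj) = step (a⊆b _ _ im) (Reach-mono a⊆b mj)

  -- Deleting vertex 0 and joining each pair of its neighbours preserves walks between the other vertices.
  module EliminateZero {n} (a : Adjacency (suc n)) where

    shortcut : Adjacency n
    shortcut i j = a (suc i) (suc j) ∨ (a (suc i) zero ∧ a zero (suc j))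

    lift : ∀ {i j} → Reach shortcut i j → Reach a (suc i) (suc j)
    lift here = here
    lift (step {i} {k} ik kj) with a (suc i) (suc k) in direct | a (suc i) zero in to₀ | a zero (suc k) in from₀
    ... | true  | _    | _    = step (subst T (sym direct) tt) (lift kj)
    ... | false | true | true = step (subst T (sym to₀) tt) (step (subst T (sym from₀) tt) (lift kj))

    FromTo : Fin (suc n) → Fin n → Set
    FromTo zero    j = ∃ λ k → T (a zero (suc k)) × Reach shortcut k j
    FromTo (suc i) j = Reach shortcut i j

    project : ∀ {x j} → Reach a x (suc j) → FromTo x j
    project here = here
    project (step {zero}  {zero}  _  r) = project r
    project (step {zero}  {suc k} ik r) = k , ik , project r
    project (step {suc i} {suc k} ik r) = step (Equivalence.from T-∨ (inj₁ ik)) (project r)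
    project (step {suc i} {zero}  ik r) with project r
    ... | k , 0k , kj = step (Equivalence.from T-∨ (inj₂ (Equivalence.from T-∧ (ik , 0k)))) kj

    ToZero : Fin (suc n) → Set
    ToZero zero    = ⊤
    ToZero (suc i) = ∃ λ k → Reach shortcut i k × T (a (suc k) zero)

    project-zero : ∀ {x} → Reach a x zero → ToZero x
    project-zero {zero}  _                         = tt
    project-zero {suc i} (step {k = zero}  i0 _)   = i , here , i0
    project-zero {suc i} (step {k = suc k} ik r) with project-zero r
    ... | m , km , m0 = m , step (Equivalence.from T-∨ (inj₁ ik)) km , m0

  Reach? : ∀ {n} (a : Adjacency n) i j → Dec (Reach a i j)
  Reach? {suc n} a zero zero = yes here
  Reach? {suc n} a (suc i) (suc j) with Reach? (EliminateZero.shortcut a) i j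
  ... | yes r = yes (EliminateZero.lift a r)
  ... | no ¬r = no (¬r ∘ EliminateZero.project a)
  Reach? {suc n} a zero (suc j) with any? (λ k → T? (a zero (suc k)) ×-dec Reach? (EliminateZero.shortcut a) k j)
  ... | yes (k , 0k , kj) = yes (step 0k (EliminateZero.lift a kj))
  ... | no ¬r             = no (¬r ∘ EliminateZero.project a)
  Reach? {suc n} a (suc i) zero with any? (λ k → Reach? (EliminateZero.shortcut a) i k ×-dec T? (a (suc k) zero))
  ... | yes (k , ik , k0) = yes (Reach-trans (EliminateZero.lift a ik) (step k0 here))
  ... | no ¬r             = no (¬r ∘ EliminateZero.project-zero a)

  ClassLabelling : ∀ {n} → (Fin n → Fin n → Set) → ℕ → Set
  ClassLabelling {n} R N =
    Σ (Fin n → Fin N) λ c → (∀ y → ∃ λ i → c i ≡ y) × (∀ i j → (c i ≡ c j) ⇔ R i j)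

  restrict-suc : ∀ {n} {R : Fin (suc n) → Fin (suc n) → Set} →
    IsDecEquivalence R → IsDecEquivalence (λ i j → R (suc i) (suc j))
  restrict-suc R-dec = record
    { isEquivalence = record { refl = E.refl ; sym = E.sym ; trans = E.trans }
    ; _≟_           = λ i j → suc i E.≟ suc j
    }
    where module E = IsDecEquivalence R-dec

  equivalence-classes : ∀ {n} {R : Fin n → Fin n → Set} → IsDecEquivalence R → ∃ (ClassLabelling R)
  equivalence-classes {zero}      R-dec = 0 , (λ ()) , (λ ()) , (λ ())
  equivalence-classes {suc n} {R} R-dec with equivalence-classes (restrict-suc R-dec)
  ... | N , c , c-onto , c-classes with any? (λ j → zero E.≟ suc j)
    where module E = IsDecEquivalence R-dec
  ...   | yes (j , 0~j) = N , c₀ , (λ y → let i , ci≡y = c-onto y in suc i , ci≡y) , classes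
    where
    module E = IsDecEquivalence R-dec
    c₀ : Fin (suc n) → Fin N
    c₀ zero    = c j
    c₀ (suc i) = c i
    classes : ∀ i k → (c₀ i ≡ c₀ k) ⇔ R i k
    classes zero    zero    = mk⇔ (λ _ → E.refl) (λ _ → refl)
    classes zero    (suc k) = mk⇔ (λ e → E.trans 0~j (Equivalence.to (c-classes j k) e))
                                  (λ r → Equivalence.from (c-classes j k) (E.trans (E.sym 0~j) r))
    classes (suc i) zero    = mk⇔ (λ e → E.sym (E.trans 0~j (Equivalence.to (c-classes j i) (sym e))))
                                  (λ r → sym (Equivalence.from (c-classes j i) (E.trans (E.sym 0~j) (E.sym r))))
    classes (suc i) (suc k) = c-classes i k
  ...   | no  alone = suc N , c₀ , onto , classes
    where
    module E = IsDecEquivalence R-dec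
    c₀ : Fin (suc n) → Fin (suc N)
    c₀ zero    = zero
    c₀ (suc i) = suc (c i)
    onto : ∀ y → ∃ λ i → c₀ i ≡ y
    onto zero    = zero , refl
    onto (suc y) = let i , ci≡y = c-onto y in suc i , cong suc ci≡y
    classes : ∀ i k → (c₀ i ≡ c₀ k) ⇔ R i k
    classes zero    zero    = mk⇔ (λ _ → E.refl) (λ _ → refl)
    classes zero    (suc k) = mk⇔ (λ ()) (λ r → ⊥-elim (alone (k , r)))
    classes (suc i) zero    = mk⇔ (λ ()) (λ r → ⊥-elim (alone (i , E.sym r)))
    classes (suc i) (suc k) =
      mk⇔ (Equivalence.to (c-classes i k) ∘ suc-injective) (cong suc ∘ Equivalence.from (c-classes i k))

  components-exist : ∀ {n} (a : Adjacency n) → SymmetricAdj a → ∃ (HasComponents a)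
  components-exist a sym-a =
    let N , c , c-onto , c-classes = equivalence-classes Reach-isDecEquivalence
    in N , c , (λ y → let i , ci≡y = c-onto y in i , λ { refl → ci≡y }) , c-classes
    where
    Reach-isDecEquivalence : IsDecEquivalence (Reach a)
    Reach-isDecEquivalence = record
      { isEquivalence = record { refl = here ; sym = Reach-sym sym-a ; trans = Reach-trans }
      ; _≟_           = Reach? a
      }

  module _ {n} {a b : Adjacency n} {N M} (a-comps : HasComponents a N) (b-comps : HasComponents b M)
           (b⊆a : ∀ {i j} → Reach b i j → Reach a i j) where

    private
      c = proj₁ a-comps
      d = proj₁ b-comps
      representative : Fin N → Fin n
      representative k = proj₁ (proj₁ (proj₂ a-comps) k)
      c-representative : ∀ k → c (representative k) ≡ k
      c-representative k = proj₂ (proj₁ (proj₂ a-comps) k) refl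
      same-c : ∀ {i j} → d i ≡ d j → c i ≡ c j
      same-c {i} {j} di≡dj =
        Equivalence.from (proj₂ (proj₂ a-comps) i j) (b⊆a (Equivalence.to (proj₂ (proj₂ b-comps) i j) di≡dj))
      refine : Fin N → Fin M
      refine k = d (representative k)
      refine-injective : ∀ {k k′} → refine k ≡ refine k′ → k ≡ k′
      refine-injective {k} {k′} eq = trans (sym (c-representative k)) (trans (same-c eq) (c-representative k′))

    fewer-components : N ≤ M
    fewer-components = injective⇒≤ refine-injective

    strictly-fewer-components : ∀ {u w} → Reach a u w → ¬ Reach b u w → N < M
    strictly-fewer-components {u} {w} uw ¬uw = injective⇒≤ {f = extend} extend-injective
      where
      k₀ = c u
      outside : ∃ λ w₀ → c w₀ ≡ k₀ × d w₀ ≢ refine k₀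
      outside with d u ≟ refine k₀
      ... | no  du≢ = u , refl , du≢
      ... | yes du≡ = w , sym (Equivalence.from (proj₂ (proj₂ a-comps) u w) uw) ,
                      λ dw≡ → ¬uw (Equivalence.to (proj₂ (proj₂ b-comps) u w) (trans du≡ (sym dw≡)))
      w₀ = proj₁ outside
      new : ∀ k → d w₀ ≢ refine k
      new k dw₀≡ = proj₂ (proj₂ outside) (subst (λ k′ → d w₀ ≡ refine k′) (sym k₀≡k) dw₀≡)
        where
        k₀≡k : k₀ ≡ k
        k₀≡k = trans (sym (proj₁ (proj₂ outside))) (trans (same-c dw₀≡) (c-representative k))
      extend : Fin (suc N) → Fin M
      extend zero    = d w₀
      extend (suc k) = refine k
      extend-injective : ∀ {k k′} → extend k ≡ extend k′ → k ≡ k′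
      extend-injective {zero}  {zero}   _  = refl
      extend-injective {zero}  {suc k′} eq = ⊥-elim (new k′ eq)
      extend-injective {suc k} {zero}   eq = ⊥-elim (new k (sym eq))
      extend-injective {suc k} {suc k′} eq = cong suc (refine-injective eq)

  Labelling : ℕ → ℕ → Set
  Labelling n M = Fin n → Maybe (Fin M)

  ConstantOnLabels : ∀ {n M} → Labelling n M → Bipartition n → Set
  ConstantOnLabels L σ = ∀ {x} i j → L i ≡ just x → L j ≡ just x → σ i ≡ σ j

  Onto : ∀ {n M} → Labelling n M → Set
  Onto L = ∀ y → ∃ λ i → L i ≡ just y

  unlabelled : ∀ {n M} → Labelling n M → ℕ
  unlabelled L = count (is-nothing ∘ L)

  nothing≢just : ∀ {A : Set} {x : A} → nothing ≢ just x
  nothing≢just ()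

  -- `nothing` marks a vertex in no class (an isolated vertex), which may lie on either side.
  LabelCountFormula : ℕ → Set
  LabelCountFormula n = ∀ {M} (L : Labelling n M) → Onto L → (Q : Bipartition n → Bool) →
    (∀ σ → T (Q σ) ⇔ ConstantOnLabels L σ) → countBip n Q ≡ 2 ^ (M + unlabelled L)

  2^-double : ∀ k → 2 ^ k + 2 ^ k ≡ 2 ^ suc k
  2^-double k = cong (2 ^ k +_) (sym (+-identityʳ (2 ^ k)))

  deleteLabel : ∀ {M} → Fin (suc M) → Maybe (Fin (suc M)) → Maybe (Fin M)
  deleteLabel m nothing  = nothing
  deleteLabel m (just y) with m ≟ y
  ... | yes _   = nothing
  ... | no  m≢y = just (punchOut m≢y)

  deleteLabel-just : ∀ {M} (m y : Fin (suc M)) (m≢y : m ≢ y) → deleteLabel m (just y) ≡ just (punchOut m≢y)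
  deleteLabel-just m y m≢y with m ≟ y
  ... | yes m≡y = ⊥-elim (m≢y m≡y)
  ... | no  _   = cong just (punchOut-cong m refl)

  deleteLabel≡just : ∀ {M} (m : Fin (suc M)) l {x} → deleteLabel m l ≡ just x → l ≡ just (punchIn m x)
  deleteLabel≡just m (just y) eq with m ≟ y
  ... | no m≢y = cong just (trans (sym (punchIn-punchOut m≢y)) (cong (punchIn m) (just-injective eq)))

  is-nothing-deleteLabel : ∀ {M} (m : Fin (suc M)) l → l ≢ just m → is-nothing (deleteLabel m l) ≡ is-nothing l
  is-nothing-deleteLabel m nothing  _     = refl
  is-nothing-deleteLabel m (just y) l≢m with m ≟ y
  ... | yes refl = ⊥-elim (l≢m refl)
  ... | no  _    = refl

  module _ {n} (count-n : LabelCountFormula n) where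

    count-unlabelled-head : ∀ {M} (L : Labelling (suc n) M) → L zero ≡ nothing → Onto L →
      (Q : Bipartition (suc n) → Bool) → (∀ σ → T (Q σ) ⇔ ConstantOnLabels L σ) →
      countBip (suc n) Q ≡ 2 ^ (M + unlabelled L)
    count-unlabelled-head {M} L L₀ onto Q Q⇔ = begin
      countBip n (Q ∘ (true ∷_)) + countBip n (Q ∘ (false ∷_))
        ≡⟨ cong₂ _+_ (count-n (L ∘ suc) onto′ _ (tail⇔ true)) (count-n (L ∘ suc) onto′ _ (tail⇔ false)) ⟩
      2 ^ (M + unlabelled (L ∘ suc)) + 2 ^ (M + unlabelled (L ∘ suc))
        ≡⟨ 2^-double (M + unlabelled (L ∘ suc)) ⟩
      2 ^ suc (M + unlabelled (L ∘ suc))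
        ≡⟨ cong (2 ^_) (+-suc M _) ⟨
      2 ^ (M + suc (unlabelled (L ∘ suc)))
        ≡⟨ cong (λ l → 2 ^ (M + (𝟙 (is-nothing l) + unlabelled (L ∘ suc)))) L₀ ⟨
      2 ^ (M + unlabelled L)
        ∎
      where
      open ≡-Reasoning
      onto′ : Onto (L ∘ suc)
      onto′ y with onto y
      ... | zero  , L₀≡y = ⊥-elim (nothing≢just (trans (sym L₀) L₀≡y))
      ... | suc i , Li≡y = i , Li≡y
      tail⇔ : ∀ b σ → T (Q (b ∷ σ)) ⇔ ConstantOnLabels (L ∘ suc) σ
      tail⇔ b σ = mk⇔ (λ q {x} i j → Equivalence.to (Q⇔ (b ∷ σ)) q {x} (suc i) (suc j))
                      (λ c → Equivalence.from (Q⇔ (b ∷ σ)) (extend c))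
        where
        extend : ConstantOnLabels (L ∘ suc) σ → ConstantOnLabels L (b ∷ σ)
        extend c zero    zero    _   _   = refl
        extend c zero    (suc j) L₀≡x _    = ⊥-elim (nothing≢just (trans (sym L₀) L₀≡x))
        extend c (suc i) zero    _    L₀≡x = ⊥-elim (nothing≢just (trans (sym L₀) L₀≡x))
        extend c (suc i) (suc j) Li  Lj  = c i j Li Lj

    count-shared-head : ∀ {M} (L : Labelling (suc n) M) {m} j → L zero ≡ just m → L (suc j) ≡ just m → Onto L →
      (Q : Bipartition (suc n) → Bool) → (∀ σ → T (Q σ) ⇔ ConstantOnLabels L σ) →
      countBip (suc n) Q ≡ 2 ^ (M + unlabelled L)
    count-shared-head {M} L {m} j L₀ Lj onto Q Q⇔ = begin
      countBip n (Q ∘ (true ∷_)) + countBip n (Q ∘ (false ∷_))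
        ≡⟨ cong₂ _+_ (countBip-cong n (head-forced true)) (countBip-cong n (head-forced false)) ⟩
      countBip n (λ σ → σ j ∧ Q′ σ) + countBip n (λ σ → not (σ j) ∧ Q′ σ)
        ≡⟨ countBip-split n (λ σ → σ j) Q′ ⟩
      countBip n Q′
        ≡⟨ count-n (L ∘ suc) onto′ Q′ Q′⇔ ⟩
      2 ^ (M + unlabelled (L ∘ suc))
        ≡⟨ cong (λ l → 2 ^ (M + (𝟙 (is-nothing l) + unlabelled (L ∘ suc)))) L₀ ⟨
      2 ^ (M + unlabelled L)
        ∎
      where
      open ≡-Reasoning
      Q′ : Bipartition n → Bool
      Q′ σ = Q (σ j ∷ σ)
      onto′ : Onto (L ∘ suc)
      onto′ y with onto y
      ... | zero  , L₀≡y = j , trans Lj (trans (sym L₀) L₀≡y)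
      ... | suc i , Li≡y = i , Li≡y
      agrees-with-j : ∀ b σ → ConstantOnLabels L (b ∷ σ) → b ≡ σ j
      agrees-with-j b σ c = c zero (suc j) L₀ Lj
      extend : ∀ σ → ConstantOnLabels (L ∘ suc) σ → ConstantOnLabels L (σ j ∷ σ)
      extend σ c zero    zero    _    _    = refl
      extend σ c zero    (suc k) L₀≡x Lk   = c j k (trans Lj (trans (sym L₀) L₀≡x)) Lk
      extend σ c (suc k) zero    Lk   L₀≡x = c k j Lk (trans Lj (trans (sym L₀) L₀≡x))
      extend σ c (suc k) (suc l) Lk   Ll   = c k l Lk Ll
      Q′⇔ : ∀ σ → T (Q′ σ) ⇔ ConstantOnLabels (L ∘ suc) σ
      Q′⇔ σ = mk⇔ (λ q {x} k l → Equivalence.to (Q⇔ (σ j ∷ σ)) q {x} (suc k) (suc l))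
                  (λ c → Equivalence.from (Q⇔ (σ j ∷ σ)) (extend σ c))
      head-forced : ∀ b σ → Q (b ∷ σ) ≡ (if b then σ j else not (σ j)) ∧ Q′ σ
      head-forced b σ with b | σ j in σj
      ... | true  | true  = refl
      ... | false | false = refl
      ... | true  | false = T-ext (λ q → not-¬ refl (trans (agrees-with-j true σ (Equivalence.to (Q⇔ _) q)) σj)) λ ()
      ... | false | true  = T-ext (λ q → not-¬ refl (trans (agrees-with-j false σ (Equivalence.to (Q⇔ _) q)) σj)) λ ()

    count-unique-head : ∀ {M} (L : Labelling (suc n) M) {m} → L zero ≡ just m → (∀ j → L (suc j) ≢ just m) →
      Onto L → (Q : Bipartition (suc n) → Bool) → (∀ σ → T (Q σ) ⇔ ConstantOnLabels L σ) →
      countBip (suc n) Q ≡ 2 ^ (M + unlabelled L)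
    count-unique-head {zero}  L {()}
    count-unique-head {suc M} L {m} L₀ unique onto Q Q⇔ = begin
      countBip n (Q ∘ (true ∷_)) + countBip n (Q ∘ (false ∷_))
        ≡⟨ cong₂ _+_ (count-n L′ onto′ _ (tail⇔ true)) (count-n L′ onto′ _ (tail⇔ false)) ⟩
      2 ^ (M + unlabelled L′) + 2 ^ (M + unlabelled L′)
        ≡⟨ 2^-double (M + unlabelled L′) ⟩
      2 ^ (suc M + unlabelled L′)
        ≡⟨ cong (λ k → 2 ^ (suc M + k)) same-unlabelled ⟩
      2 ^ (suc M + unlabelled (L ∘ suc))
        ≡⟨ cong (λ l → 2 ^ (suc M + (𝟙 (is-nothing l) + unlabelled (L ∘ suc)))) L₀ ⟨
      2 ^ (suc M + unlabelled L)
        ∎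
      where
      open ≡-Reasoning
      L′ : Labelling n M
      L′ = deleteLabel m ∘ L ∘ suc
      same-unlabelled : unlabelled L′ ≡ unlabelled (L ∘ suc)
      same-unlabelled = trans (count≡∑𝟙 (is-nothing ∘ L′)) (trans
        (sum-cong-≗ (λ i → cong 𝟙 (is-nothing-deleteLabel m (L (suc i)) (unique i))))
        (sym (count≡∑𝟙 (is-nothing ∘ L ∘ suc))))
      onto′ : Onto L′
      onto′ y with onto (punchIn m y)
      ... | zero  , L₀≡y = ⊥-elim (punchInᵢ≢i m y (sym (just-injective (trans (sym L₀) L₀≡y))))
      ... | suc i , Li≡y = i , trans (cong (deleteLabel m) Li≡y)
                                 (trans (deleteLabel-just m _ (punchInᵢ≢i m y ∘ sym)) (cong just (punchOut-punchIn m)))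
      tail⇔ : ∀ b σ → T (Q (b ∷ σ)) ⇔ ConstantOnLabels L′ σ
      tail⇔ b σ = mk⇔ (λ q {x} i j Li Lj → Equivalence.to (Q⇔ (b ∷ σ)) q (suc i) (suc j)
                                              (deleteLabel≡just m _ Li) (deleteLabel≡just m _ Lj))
                      (λ c → Equivalence.from (Q⇔ (b ∷ σ)) (extend c))
        where
        extend : ConstantOnLabels L′ σ → ConstantOnLabels L (b ∷ σ)
        extend c zero    zero    _    _    = refl
        extend c zero    (suc j) L₀≡x Lj   = ⊥-elim (unique j (trans Lj (trans (sym L₀≡x) L₀)))
        extend c (suc i) zero    Li   L₀≡x = ⊥-elim (unique i (trans Li (trans (sym L₀≡x) L₀)))
        extend c {x} (suc i) (suc j) Li Lj = c i j (relabel Li) (relabel Lj)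
          where
          m≢x : m ≢ x
          m≢x refl = unique i Li
          relabel : ∀ {k} → L (suc k) ≡ just x → L′ k ≡ just (punchOut m≢x)
          relabel Lk = trans (cong (deleteLabel m) Lk) (deleteLabel-just m x m≢x)

  -- Vertex 0 is unlabelled (its side is free), shares its label with a later vertex (its side is forced), or is
  -- alone in its class (its side is free and one class disappears).
  countBip-constantOnLabels : ∀ n → LabelCountFormula n
  countBip-constantOnLabels zero {zero} L onto Q Q⇔ =
    cong 𝟙 (T-ext (λ _ → tt) (λ _ → Equivalence.from (Q⇔ (λ ())) (λ ())))
  countBip-constantOnLabels zero {suc M} L onto Q Q⇔ with onto zero
  ... | () , _
  countBip-constantOnLabels (suc n) {M} L onto Q Q⇔ = by-head (L zero) refl
    where
    by-head : ∀ l → L zero ≡ l → countBip (suc n) Q ≡ 2 ^ (M + unlabelled L)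
    by-head nothing L₀ = count-unlabelled-head (countBip-constantOnLabels n) L L₀ onto Q Q⇔
    by-head (just m) L₀ with any? (λ j → ≡-dec _≟_ (L (suc j)) (just m))
    ... | yes (j , Lj) = count-shared-head (countBip-constantOnLabels n) L j L₀ Lj onto Q Q⇔
    ... | no  unique   = count-unique-head (countBip-constantOnLabels n) L L₀ (λ j Lj → unique (j , Lj)) onto Q Q⇔

  labelWhen : ∀ {M} (b : Bool) → (T b → Fin M) → Maybe (Fin M)
  labelWhen true  f = just (f tt)
  labelWhen false f = nothing

  labelWhen-just : ∀ {M} b (f : T b → Fin M) (p : T b) → labelWhen b f ≡ just (f p)
  labelWhen-just true f p = refl

  labelWhen≡just : ∀ {M} b (f : T b → Fin M) {x} → labelWhen b f ≡ just x → Σ (T b) λ p → f p ≡ x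
  labelWhen≡just true f eq = tt , just-injective eq

  is-nothing-labelWhen : ∀ {M} b (f : T b → Fin M) → is-nothing (labelWhen b f) ≡ not b
  is-nothing-labelWhen true  f = refl
  is-nothing-labelWhen false f = refl

  module _ {n} (G : Graph n) where

    edge⇒nonIsolated : ∀ {i j} → T (adj G i j) → T (nonIsolated G i)
    edge⇒nonIsolated {i} {j} ij = fromWitness (begin
      1                          ≡⟨ cong 𝟙 (Equivalence.to T-≡ ij) ⟨
      𝟙 (adj G i j)              ≤⟨ ≤-∑ (𝟙 ∘ adj G i) j ⟩
      ∑[ k < n ] 𝟙 (adj G i k)   ≡⟨ count≡∑𝟙 (adj G i) ⟨
      deg G i                    ∎)
      where open ≤-Reasoning

    cutCount0-components : ∀ N → HasComponentsNonIso G N → cutCount G 0 * 2 ^ v G ≡ 2 ^ N * 2 ^ n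
    cutCount0-components N (c , c-onto , c-fibres) = begin
      cutCount G 0 * 2 ^ v G
        ≡⟨ cong (_* 2 ^ v G) (countBip-constantOnLabels n label label-onto (cutIs G 0) cut0⇔) ⟩
      2 ^ (N + unlabelled label) * 2 ^ v G
        ≡⟨ cong (λ k → 2 ^ (N + k) * 2 ^ v G) unlabelled≡isolated ⟩
      2 ^ (N + isolated) * 2 ^ v G
        ≡⟨ ^-distribˡ-+-* 2 (N + isolated) (v G) ⟨
      2 ^ (N + isolated + v G)
        ≡⟨ cong (2 ^_) (+-assoc N isolated (v G)) ⟩
      2 ^ (N + (isolated + v G))
        ≡⟨ cong (λ k → 2 ^ (N + k)) (trans (+-comm isolated (v G)) (count+count-not (nonIsolated G))) ⟩
      2 ^ (N + n)
        ≡⟨ ^-distribˡ-+-* 2 N n ⟩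
      2 ^ N * 2 ^ n
        ∎
      where
      open ≡-Reasoning
      isolated = count (not ∘ nonIsolated G)
      label : Labelling n N
      label i = labelWhen (nonIsolated G i) (λ p → c (i , p))
      label-onto : Onto label
      label-onto y = let (i , p) , cip≡y = c-onto y in i , trans (labelWhen-just _ _ p) (cong just (cip≡y refl))
      unlabelled≡isolated : unlabelled label ≡ isolated
      unlabelled≡isolated = trans (count≡∑𝟙 (is-nothing ∘ label)) (trans
        (sum-cong-≗ (λ i → cong 𝟙 (is-nothing-labelWhen (nonIsolated G i) _)))
        (sym (count≡∑𝟙 (not ∘ nonIsolated G))))
      same-component : ∀ {i j} → T (adj G i j) → label i ≡ label j
      same-component {i} {j} ij = trans (labelWhen-just _ _ p) (trans
        (cong just (Equivalence.from (c-fibres (i , p) (j , p′)) (step ij here)))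
        (sym (labelWhen-just _ _ p′)))
        where
        p  = edge⇒nonIsolated ij
        p′ = edge⇒nonIsolated (subst T (Graph.sym G i j) ij)
      cut0⇔ : ∀ σ → T (cutIs G 0 σ) ⇔ ConstantOnLabels label σ
      cut0⇔ σ = mk⇔ to from
        where
        to : T (cutIs G 0 σ) → ConstantOnLabels label σ
        to cut≡0 i j Li Lj with labelWhen≡just _ _ Li | labelWhen≡just _ _ Lj
        ... | p , ci≡x | p′ , cj≡x = constant-on-walks (adj G) σ
          (cut≡0⇒constant (adj G) (Graph.sym G) σ (cutIs⇒≡ G σ cut≡0))
          (Equivalence.to (c-fibres (i , p) (j , p′)) (trans ci≡x (sym cj≡x)))
        from : ConstantOnLabels label σ → T (cutIs G 0 σ)
        from const = ≡⇒≡ᵇ _ 0 (constant⇒cut≡0 (adj G) σ λ i j ij →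
          let p = edge⇒nonIsolated ij
          in const i j (labelWhen-just _ _ p) (trans (sym (same-component ij)) (labelWhen-just _ _ p)))

  -- Removing an edge; bridges

  module _ {n} (G : Graph n) (x y : Fin n) where

    G⁻ : Adjacency n
    G⁻ = removeEdge G x y

    removeEdge-sym : SymmetricAdj (G⁻)
    removeEdge-sym i j = cong₂ (λ e r → e ∧ not r) (Graph.sym G i j)
      (trans (cong₂ _∨_ (∧-comm ⌊ i ≟ x ⌋ ⌊ j ≟ y ⌋) (∧-comm ⌊ i ≟ y ⌋ ⌊ j ≟ x ⌋))
             (∨-comm (⌊ j ≟ y ⌋ ∧ ⌊ i ≟ x ⌋) _))

    removeEdge⊆adj : ∀ i j → T (G⁻ i j) → T (adj G i j)
    removeEdge⊆adj i j t = proj₁ (Equivalence.to T-∧ t)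

    removeEdge-removed : G⁻ x y ≡ false
    removeEdge-removed with x ≟ x | y ≟ y
    ... | yes _   | yes _   = ∧-zeroʳ (adj G x y)
    ... | no  x≢x | _       = ⊥-elim (x≢x refl)
    ... | yes _   | no  y≢y = ⊥-elim (y≢y refl)

    removeEdge-kept : ∀ {i j} → ¬ (i ≡ x × j ≡ y) → ¬ (i ≡ y × j ≡ x) → G⁻ i j ≡ adj G i j
    removeEdge-kept {i} {j} ¬xy ¬yx =
      trans (cong₂ (λ p q → adj G i j ∧ not (p ∨ q)) (not-both ¬xy) (not-both ¬yx)) (∧-identityʳ (adj G i j))
      where
      not-both : ∀ {u w} → ¬ (i ≡ u × j ≡ w) → (⌊ i ≟ u ⌋ ∧ ⌊ j ≟ w ⌋) ≡ false
      not-both {u} {w} ¬uw with i ≟ u | j ≟ w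
      ... | yes i≡u | yes j≡w = ⊥-elim (¬uw (i≡u , j≡w))
      ... | yes _   | no  _   = refl
      ... | no  _   | _       = refl

    Reach-rerouted : Reach (G⁻) x y → ∀ {i j} → Reach (adj G) i j → Reach (G⁻) i j
    Reach-rerouted xy⁻ here = here
    Reach-rerouted xy⁻ (step {i} {k} ik kj) with i ≟ x ×-dec k ≟ y | i ≟ y ×-dec k ≟ x
    ... | yes (refl , refl) | _                 = Reach-trans xy⁻ (Reach-rerouted xy⁻ kj)
    ... | no _              | yes (refl , refl) = Reach-trans (Reach-sym removeEdge-sym xy⁻) (Reach-rerouted xy⁻ kj)
    ... | no ¬xy            | no ¬yx            =
      step (subst T (sym (removeEdge-kept ¬xy ¬yx)) ik) (Reach-rerouted xy⁻ kj)

    bridge⇒disconnects : IsBridge G x y → ¬ Reach (G⁻) x y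
    bridge⇒disconnects (_ , N , N′ , G-comps , G⁻-comps , N<N′) xy⁻ =
      <⇒≱ N<N′ (fewer-components G⁻-comps G-comps (Reach-rerouted xy⁻))

    disconnects⇒bridge : T (adj G x y) → ¬ Reach (G⁻) x y → IsBridge G x y
    disconnects⇒bridge xy ¬xy⁻ = xy , N , N′ , G-comps , G⁻-comps ,
      strictly-fewer-components G-comps G⁻-comps (Reach-mono removeEdge⊆adj) (step xy here) ¬xy⁻
      where
      N = proj₁ (components-exist (adj G) (Graph.sym G))
      G-comps = proj₂ (components-exist (adj G) (Graph.sym G))
      N′ = proj₁ (components-exist (G⁻) removeEdge-sym)
      G⁻-comps = proj₂ (components-exist (G⁻) removeEdge-sym)

    module _ (xy : T (adj G x y)) (x<y : toℕ x < toℕ y) where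

      cut-removeEdge : ∀ σ → cut (adj G) σ ≡ cut (G⁻) σ + 𝟙 (σ x xor σ y)
      cut-removeEdge σ = begin
        cut (adj G) σ                            ≡⟨ cut≡∑∑ (adj G) σ ⟩
        ∑∑ (adj G)                               ≡⟨ +-identityʳ _ ⟨
        ∑∑ (adj G) + 0                           ≡⟨ cong (λ c → ∑∑ (adj G) + 𝟙 c) removed-not-crossing ⟨
        ∑∑ (adj G) + X G⁻ x y                    ≡⟨ ∑∑-except-one (X (adj G)) (X G⁻) x y kept ⟩
        ∑∑ G⁻ + X (adj G) x y                    ≡⟨ cong₂ _+_ (sym (cut≡∑∑ G⁻ σ)) (cong 𝟙 (crosses-edge (adj G) σ x<y xy)) ⟩
        cut G⁻ σ + 𝟙 (σ x xor σ y)               ∎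
        where
        open ≡-Reasoning
        X : Adjacency n → Fin n → Fin n → ℕ
        X a i j = 𝟙 (crosses a σ i j)
        ∑∑ : Adjacency n → ℕ
        ∑∑ a = ∑[ i < n ] sum (X a i)
        removed-not-crossing : crosses (G⁻) σ x y ≡ false
        removed-not-crossing = trans
          (cong ((toℕ x <ᵇ toℕ y) ∧_) (crossing-false (G⁻) σ (λ t → ⊥-elim (subst T removeEdge-removed t))))
          (∧-zeroʳ _)
        kept : ∀ i j → ¬ (i ≡ x × j ≡ y) → X (adj G) i j ≡ X (G⁻) i j
        kept i j ¬xy with i ≟ y ×-dec j ≟ x
        ... | yes (refl , refl) rewrite <ᵇ-false (<⇒≤ x<y) = refl
        ... | no  ¬yx           =
          cong (λ e → 𝟙 ((toℕ i <ᵇ toℕ j) ∧ e ∧ (σ i xor σ j))) (sym (removeEdge-kept ¬xy ¬yx))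

      cut≡1-separates : ∀ σ → T (σ x xor σ y) → cut (adj G) σ ≡ 1 → ¬ Reach (G⁻) x y
      cut≡1-separates σ separated cut≡1 xy⁻ = subst T (trans (cong (_xor σ y) σx≡σy) (xor-same (σ y))) separated
        where
        rest≡0 : cut (G⁻) σ ≡ 0
        rest≡0 = +-cancelʳ-≡ 1 _ _ (begin
          cut (G⁻) σ + 1
            ≡⟨ cong (λ b → cut (G⁻) σ + 𝟙 b) (Equivalence.to T-≡ separated) ⟨
          cut (G⁻) σ + 𝟙 (σ x xor σ y)
            ≡⟨ cut-removeEdge σ ⟨
          cut (adj G) σ
            ≡⟨ cut≡1 ⟩
          1
            ∎)
          where open ≡-Reasoning
        σx≡σy : σ x ≡ σ y
        σx≡σy = constant-on-walks _ σ (cut≡0⇒constant _ removeEdge-sym σ rest≡0) xy⁻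

      separating-cut≡1-count : ¬ Reach (G⁻) x y →
        countBip n (λ σ → (σ x xor σ y) ∧ cutIs G 1 σ) ≡ cutCount G 0
      separating-cut≡1-count ¬xy⁻ = begin
        countBip n (λ σ → (σ x xor σ y) ∧ cutIs G 1 σ)
          ≡⟨ countBip-cong n (λ σ → trans (cut≡1-form σ) (sym (Q-⊕-side σ))) ⟩
        countBip n (λ σ → Q (side ⊕ σ))
          ≡⟨ countBip-⊕ n Q side Q-resp ⟩
        countBip n Q
          ≡⟨ countBip-cong n (λ σ → sym (cut≡0-form σ)) ⟩
        cutCount G 0
          ∎
        where
        open ≡-Reasoning
        rest : Bipartition n → ℕ
        rest = cut (G⁻)
        Q : Bipartition n → Bool
        Q σ = not (σ x xor σ y) ∧ (rest σ ≡ᵇ 0)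
        Q-resp : RespectsPointwise Q
        Q-resp σ≗τ = cong₂ (λ s r → not s ∧ (r ≡ᵇ 0)) (cong₂ _xor_ (σ≗τ x) (σ≗τ y)) (cut-cong _ σ≗τ)
        cut≡1-form : ∀ σ → ((σ x xor σ y) ∧ cutIs G 1 σ) ≡ ((σ x xor σ y) ∧ (rest σ ≡ᵇ 0))
        cut≡1-form σ =
          trans (cong (λ c → (σ x xor σ y) ∧ (c ≡ᵇ 1)) (cut-removeEdge σ)) (split (σ x xor σ y) (rest σ))
          where
          split : ∀ t r → (t ∧ ((r + 𝟙 t) ≡ᵇ 1)) ≡ (t ∧ (r ≡ᵇ 0))
          split true  r rewrite +-comm r 1 = refl
          split false r = refl
        cut≡0-form : ∀ σ → cutIs G 0 σ ≡ Q σ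
        cut≡0-form σ = trans (cong (_≡ᵇ 0) (cut-removeEdge σ)) (split (σ x xor σ y) (rest σ))
          where
          split : ∀ t r → ((r + 𝟙 t) ≡ᵇ 0) ≡ (not t ∧ (r ≡ᵇ 0))
          split true  r rewrite +-comm r 1 = refl
          split false r rewrite +-identityʳ r = refl
        -- Moving the component of x in G − xy switches whether xy is cut and keeps the rest of the cut empty.
        side : Bipartition n
        side u = ⌊ Reach? (G⁻) u x ⌋
        side-constant : ConstantOnEdges (G⁻) side
        side-constant u w uw = T-ext
          (λ ux → fromWitness (Reach-trans (step (subst T (removeEdge-sym u w) uw) here) (toWitness ux)))
          (λ wx → fromWitness (step uw (toWitness wx)))
        side-x : side x ≡ true
        side-x = Equivalence.to T-≡ (fromWitness here)
        side-y : side y ≡ false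
        side-y with Reach? (G⁻) y x
        ... | yes yx⁻ = ⊥-elim (¬xy⁻ (Reach-sym removeEdge-sym yx⁻))
        ... | no  _   = refl
        Q-⊕-side : ∀ σ → Q (side ⊕ σ) ≡ ((σ x xor σ y) ∧ (rest σ ≡ᵇ 0))
        Q-⊕-side σ = cong₂ _∧_ swapped (cut≡ᵇ0-⊕ _ removeEdge-sym side-constant σ)
          where
          swapped : not ((side x xor σ x) xor (side y xor σ y)) ≡ (σ x xor σ y)
          swapped rewrite side-x | side-y = trans (cong not (sym (not-distribˡ-xor (σ x) (σ y)))) (not-involutive _)

  _≟ₚ_ : ∀ {n} → DecidableEquality (Fin n × Fin n)
  _≟ₚ_ = ×-≡-dec _≟_ _≟_

  _∈ₚ?_ : ∀ {n} (p : Fin n × Fin n) bs → Dec (p ∈ bs)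
  p ∈ₚ? bs = Any.any? (p ≟ₚ_) bs

  ∑∑-point : ∀ {n} (p : Fin n × Fin n) → ∑[ i < n ] ∑[ j < n ] 𝟙 ⌊ (i , j) ≟ₚ p ⌋ ≡ 1
  ∑∑-point {n} (k , l) = trans (∑-concentrated (λ i → ∑[ j < n ] 𝟙 ⌊ (i , j) ≟ₚ (k , l) ⌋) k off-row)
    (trans (∑-concentrated (λ j → 𝟙 ⌊ (k , j) ≟ₚ (k , l) ⌋) l off-column) (𝟙-true (fromWitness refl)))
    where
    off-row : ∀ i → i ≢ k → ∑[ j < n ] 𝟙 ⌊ (i , j) ≟ₚ (k , l) ⌋ ≡ 0
    off-row i i≢k = ∑-zero (λ j → 𝟙 ⌊ (i , j) ≟ₚ (k , l) ⌋) (λ j → 𝟙-false (i≢k ∘ cong proj₁ ∘ toWitness))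
    off-column : ∀ j → j ≢ l → 𝟙 ⌊ (k , j) ≟ₚ (k , l) ⌋ ≡ 0
    off-column j j≢l = 𝟙-false (j≢l ∘ cong proj₂ ∘ toWitness)

  𝟙∈-∷ : ∀ {n} {b : Fin n × Fin n} {bs} → b ∉ bs →
    ∀ p → 𝟙 ⌊ p ∈ₚ? (b List.∷ bs) ⌋ ≡ 𝟙 ⌊ p ≟ₚ b ⌋ + 𝟙 ⌊ p ∈ₚ? bs ⌋
  𝟙∈-∷ {b = b} {bs} b∉bs p = by-cases (p ≟ₚ b)
    where
    by-cases : Dec (p ≡ b) → 𝟙 ⌊ p ∈ₚ? (b List.∷ bs) ⌋ ≡ 𝟙 ⌊ p ≟ₚ b ⌋ + 𝟙 ⌊ p ∈ₚ? bs ⌋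
    by-cases (yes refl) = trans (𝟙-true (fromWitness (here refl)))
      (sym (cong₂ _+_ (𝟙-true {⌊ b ≟ₚ b ⌋} (fromWitness refl))
                      (𝟙-false {⌊ b ∈ₚ? bs ⌋} (b∉bs ∘ toWitness))))
    by-cases (no p≢b) = trans
      (cong 𝟙 (T-ext (λ t → fromWitness (in-tail (toWitness t))) (λ t → fromWitness (there (toWitness t)))))
      (cong (_+ 𝟙 ⌊ p ∈ₚ? bs ⌋) (sym (𝟙-false {⌊ p ≟ₚ b ⌋} (p≢b ∘ toWitness))))
      where
      in-tail : p ∈ b List.∷ bs → p ∈ bs
      in-tail (here p≡b)   = ⊥-elim (p≢b p≡b)
      in-tail (there p∈bs) = p∈bs

  ∑∑-∈-Unique : ∀ {n} (bs : List (Fin n × Fin n)) → Unique bs →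
    ∑[ i < n ] ∑[ j < n ] 𝟙 ⌊ (i , j) ∈ₚ? bs ⌋ ≡ length bs
  ∑∑-∈-Unique {n} List.[] AllPairs.[] =
    ∑-zero {n} (λ i → ∑[ j < n ] 0) (λ i → ∑-zero {n} (λ j → 0) (λ j → refl))
  ∑∑-∈-Unique {n} (b List.∷ bs) (b∉ AllPairs.∷ unique) = begin
    ∑[ i < n ] ∑[ j < n ] 𝟙 ⌊ (i , j) ∈ₚ? (b List.∷ bs) ⌋
      ≡⟨ sum-cong-≗ (λ i → trans (sum-cong-≗ (λ j → 𝟙∈-∷ (All¬⇒¬Any b∉) (i , j)))
                                 (∑-distrib-+ (At i) (In i))) ⟩
    ∑[ i < n ] (sum (At i) + sum (In i))
      ≡⟨ ∑-distrib-+ (sum ∘ At) (sum ∘ In) ⟩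
    ∑[ i < n ] sum (At i) + ∑[ i < n ] sum (In i)
      ≡⟨ cong₂ _+_ (∑∑-point b) (∑∑-∈-Unique bs unique) ⟩
    suc (length bs)
      ∎
    where
    open ≡-Reasoning
    At In : Fin n → Fin n → ℕ
    At i j = 𝟙 ⌊ (i , j) ≟ₚ b ⌋
    In i j = 𝟙 ⌊ (i , j) ∈ₚ? bs ⌋

  module _ {n} (G : Graph n) where

    crossingCut1Count : Fin n → Fin n → ℕ
    crossingCut1Count i j = countBip n (λ σ → crosses (adj G) σ i j ∧ cutIs G 1 σ)

    cutCount1≡∑∑ : cutCount G 1 ≡ ∑[ i < n ] ∑[ j < n ] crossingCut1Count i j
    cutCount1≡∑∑ = begin
      cutCount G 1
        ≡⟨ countBip≡sumBip n (cutIs G 1) ⟩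
      sumBip n (𝟙 ∘ cutIs G 1)
        ≡⟨ sumBip-cong n one-crossing ⟩
      sumBip n (λ σ → ∑[ i < n ] ∑[ j < n ] Y i j σ)
        ≡⟨ sumBip-∑-comm n (λ i σ → ∑[ j < n ] Y i j σ) ⟩
      ∑[ i < n ] sumBip n (λ σ → ∑[ j < n ] Y i j σ)
        ≡⟨ sum-cong-≗ (λ i → sumBip-∑-comm n (Y i)) ⟩
      ∑[ i < n ] ∑[ j < n ] sumBip n (Y i j)
        ≡⟨ sum-cong-≗ (λ i → sum-cong-≗ (λ j →
             countBip≡sumBip n (λ σ → crosses (adj G) σ i j ∧ cutIs G 1 σ))) ⟨
      ∑[ i < n ] ∑[ j < n ] crossingCut1Count i j
        ∎
      where
      open ≡-Reasoning
      Y : Fin n → Fin n → Bipartition n → ℕ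
      Y i j σ = 𝟙 (crosses (adj G) σ i j ∧ cutIs G 1 σ)
      ∑-*ʳ : ∀ (f : Fin n → ℕ) c → ∑[ i < n ] (f i * c) ≡ sum f * c
      ∑-*ʳ f c = sym (*-distribʳ-sum c f)
      m*𝟙[m≡1] : ∀ m → m * 𝟙 (m ≡ᵇ 1) ≡ 𝟙 (m ≡ᵇ 1)
      m*𝟙[m≡1] zero          = refl
      m*𝟙[m≡1] (suc zero)    = refl
      m*𝟙[m≡1] (suc (suc m)) = *-zeroʳ (suc (suc m))
      one-crossing : ∀ σ → 𝟙 (cutIs G 1 σ) ≡ ∑[ i < n ] ∑[ j < n ] Y i j σ
      one-crossing σ = sym (begin
        ∑[ i < n ] ∑[ j < n ] Y i j σ
          ≡⟨ sum-cong-≗ (λ i → sum-cong-≗ (λ j → 𝟙-∧ (crosses (adj G) σ i j) _)) ⟩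
        ∑[ i < n ] ∑[ j < n ] (X i j * 𝟙 (cutIs G 1 σ))
          ≡⟨ sum-cong-≗ (λ i → ∑-*ʳ (X i) _) ⟩
        ∑[ i < n ] (sum (X i) * 𝟙 (cutIs G 1 σ))
          ≡⟨ ∑-*ʳ (sum ∘ X) _ ⟩
        ∑[ i < n ] sum (X i) * 𝟙 (cutIs G 1 σ)
          ≡⟨ cong (_* 𝟙 (cutIs G 1 σ)) (cut≡∑∑ (adj G) σ) ⟨
        cut (adj G) σ * 𝟙 (cutIs G 1 σ)
          ≡⟨ m*𝟙[m≡1] (cut (adj G) σ) ⟩
        𝟙 (cutIs G 1 σ)
          ∎)
        where
        X : Fin n → Fin n → ℕ
        X i j = 𝟙 (crosses (adj G) σ i j)

    crossingCut1Count-bridge : ∀ {i j} → toℕ i < toℕ j → IsBridge G i j → crossingCut1Count i j ≡ cutCount G 0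
    crossingCut1Count-bridge {i} {j} i<j bridge@(ij , _) = trans
      (countBip-cong n (λ σ → cong (_∧ cutIs G 1 σ) (crosses-edge (adj G) σ i<j ij)))
      (separating-cut≡1-count G i j ij i<j (bridge⇒disconnects G i j bridge))

    crossingCut1Count-nonbridge : ∀ {i j} → ¬ (toℕ i < toℕ j × IsBridge G i j) → crossingCut1Count i j ≡ 0
    crossingCut1Count-nonbridge {i} {j} not-bridge = countBip-none n _ λ σ t →
      let crosses-ij , cut≡1 = Equivalence.to T-∧ t
          ordered , edge-crossing = Equivalence.to T-∧ crosses-ij
          ij , separated = Equivalence.to T-∧ edge-crossing
          i<j = <ᵇ⇒< (toℕ i) (toℕ j) ordered
      in not-bridge (i<j , disconnects⇒bridge G i j ij
                             (cut≡1-separates G i j ij i<j σ separated (cutIs⇒≡ G σ cut≡1)))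

    cutCount1-bridges : ∀ m → HasBridges G m → cutCount G 1 ≡ m * cutCount G 0
    cutCount1-bridges m (bs , unique , length≡m , bs⇔bridges) = begin
      cutCount G 1
        ≡⟨ cutCount1≡∑∑ ⟩
      ∑[ i < n ] ∑[ j < n ] crossingCut1Count i j
        ≡⟨ sum-cong-≗ (λ i → sum-cong-≗ (per-pair i)) ⟩
      ∑[ i < n ] ∑[ j < n ] (Bridge i j * cutCount G 0)
        ≡⟨ sum-cong-≗ (λ i → sym (*-distribʳ-sum (cutCount G 0) (Bridge i))) ⟩
      ∑[ i < n ] (sum (Bridge i) * cutCount G 0)
        ≡⟨ sym (*-distribʳ-sum (cutCount G 0) (sum ∘ Bridge)) ⟩
      ∑[ i < n ] sum (Bridge i) * cutCount G 0
        ≡⟨ cong (_* cutCount G 0) (trans (∑∑-∈-Unique bs unique) length≡m) ⟩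
      m * cutCount G 0
        ∎
      where
      open ≡-Reasoning
      Bridge : Fin n → Fin n → ℕ
      Bridge i j = 𝟙 ⌊ (i , j) ∈ₚ? bs ⌋
      per-pair : ∀ i j → crossingCut1Count i j ≡ Bridge i j * cutCount G 0
      per-pair i j with (i , j) ∈ₚ? bs
      ... | yes ij∈bs = let i<j , bridge = Equivalence.to (bs⇔bridges i j) ij∈bs
                        in trans (crossingCut1Count-bridge i<j bridge) (sym (+-identityʳ _))
      ... | no  ij∉bs = crossingCut1Count-nonbridge (ij∉bs ∘ Equivalence.from (bs⇔bridges i j))

open Cuts
open import Data.Nat using (ℕ; _^_; _%_; _*_)
open import Data.Fin using (Fin)
open import Data.Rational using (ℚ; _≤_; ½; _/_) renaming (_*_ to _*ℚ_)
open import Data.Integer using (+_)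
open import Data.Product using (Σ; _×_; _,_)
open import Relation.Binary.PropositionalEquality using (_≡_)

open import Data.Nat as ℕ using (suc; NonZero)
open import Data.Nat.Properties using (m^n≢0)
import Data.Integer as ℤ
import Data.Integer.Properties as ℤ
open import Data.Rational using (toℚᵘ)
open import Data.Rational.Properties using (toℚᵘ-fromℚᵘ; toℚᵘ-cancel-≤; toℚᵘ-injective; toℚᵘ-homo-*)
import Data.Rational.Unnormalised as ℚᵘ
import Data.Rational.Unnormalised.Properties as ℚᵘ
open import Relation.Binary.PropositionalEquality using (cong; subst₂; module ≡-Reasoning)
import Data.Nat.Properties as ℕ

toℚᵘ-/ : ∀ x d → toℚᵘ (+ x / suc d) ℚᵘ.≃ ℚᵘ.mkℚᵘ (+ x) d
toℚᵘ-/ x d = toℚᵘ-fromℚᵘ _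

/≤/ : ∀ x d a b .{{_ : NonZero d}} .{{_ : NonZero b}} → x * b ℕ.≤ a * d → + x / d ≤ + a / b
/≤/ x (suc d) a (suc b) xb≤ad = toℚᵘ-cancel-≤
  (ℚᵘ.≤-respˡ-≃ (ℚᵘ.≃-sym (toℚᵘ-/ x d)) (ℚᵘ.≤-respʳ-≃ (ℚᵘ.≃-sym (toℚᵘ-/ a b))
    (ℚᵘ.*≤* (subst₂ ℤ._≤_ (ℤ.pos-* x (suc b)) (ℤ.pos-* a (suc d)) (ℤ.+≤+ xb≤ad)))))

/*ℕ→ℚ≡ℕ→ℚ : ∀ x d y z .{{_ : NonZero d}} → x * y ≡ z * d → (+ x / d) *ℚ ℕ→ℚ y ≡ ℕ→ℚ z
/*ℕ→ℚ≡ℕ→ℚ x (suc d) y z xy≡zd = toℚᵘ-injective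
  (ℚᵘ.≃-trans (toℚᵘ-homo-* (+ x / suc d) (+ y / 1)) (ℚᵘ.≃-trans (ℚᵘ.*-cong (toℚᵘ-/ x d) (toℚᵘ-/ y 0))
    (ℚᵘ.≃-sym (ℚᵘ.≃-trans (toℚᵘ-/ z 0) (ℚᵘ.*≡* cross)))))
  where
  open ≡-Reasoning
  cross : + z ℤ.* + (suc d * 1) ≡ (+ x ℤ.* + y) ℤ.* + 1
  cross = begin
    + z ℤ.* + (suc d * 1)   ≡⟨ cong (λ e → + z ℤ.* + e) (ℕ.*-identityʳ (suc d)) ⟩
    + z ℤ.* + suc d         ≡⟨ ℤ.pos-* z (suc d) ⟨
    + (z * suc d)           ≡⟨ cong +_ xy≡zd ⟨
    + (x * y)               ≡⟨ ℤ.pos-* x y ⟩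
    + x ℤ.* + y             ≡⟨ ℤ.*-identityʳ _ ⟨
    (+ x ℤ.* + y) ℤ.* + 1   ∎

/≡ℕ→ℚ*/ : ∀ x d m y .{{_ : NonZero d}} → x ≡ m * y → + x / d ≡ ℕ→ℚ m *ℚ (+ y / d)
/≡ℕ→ℚ*/ x (suc d) m y x≡my = toℚᵘ-injective
  (ℚᵘ.≃-trans (toℚᵘ-/ x d) (ℚᵘ.≃-sym (ℚᵘ.≃-trans (toℚᵘ-homo-* (+ m / 1) (+ y / suc d))
    (ℚᵘ.≃-trans (ℚᵘ.*-cong (toℚᵘ-/ m 0) (toℚᵘ-/ y d)) (ℚᵘ.*≡* cross)))))
  where
  open ≡-Reasoning
  cross : (+ m ℤ.* + y) ℤ.* + suc d ≡ + x ℤ.* + (1 * suc d)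
  cross = begin
    (+ m ℤ.* + y) ℤ.* + suc d   ≡⟨ cong (ℤ._* + suc d) (ℤ.pos-* m y) ⟨
    + (m * y) ℤ.* + suc d       ≡⟨ cong (λ e → + e ℤ.* + suc d) x≡my ⟨
    + x ℤ.* + suc d             ≡⟨ cong (λ e → + x ℤ.* + e) (ℕ.*-identityˡ (suc d)) ⟨
    + x ℤ.* + (1 * suc d)       ∎

lemma3p1 : ∀ {n} (G : Graph n) →
    (∀ N → HasComponentsNonIso G N → q G 0 *ℚ ℕ→ℚ (2 ^ v G) ≡ ℕ→ℚ (2 ^ N)) ×
    (∀ m → HasBridges G m → q G 1 ≡ ℕ→ℚ m *ℚ q G 0) ×
    (Σ (Fin n) (λ i → deg G i % 2 ≡ 1) → ∀ k → q G k ≤ ½) ×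
    (∀ k → k % 2 ≡ 1 → q G k ≤ ½) ×
    (q G 2 ≤ + 3 / 4)
lemma3p1 {n} G =
  (λ N components → /*ℕ→ℚ≡ℕ→ℚ (cutCount G 0) (2 ^ n) (2 ^ v G) (2 ^ N) (cutCount0-components G N components)) ,
  (λ m bridges → /≡ℕ→ℚ*/ (cutCount G 1) (2 ^ n) m (cutCount G 0) (cutCount1-bridges G m bridges)) ,
  (λ (u , odd) k → /≤/ (cutCount G k) (2 ^ n) 1 2 (cutCount-odd-degree G u odd k)) ,
  (λ k odd → /≤/ (cutCount G k) (2 ^ n) 1 2 (cutCount-odd G k odd)) ,
  /≤/ (cutCount G 2) (2 ^ n) 3 4 (cutCount2-bound G)
  where instance
  2^n≢0 : NonZero (2 ^ n)
  2^n≢0 = m^n≢0 2 n
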